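{- Let $a,b$ be fixed positive coprime integers and let $g,k$ be integers with $g\ge 1$ and $0\le k<g(a+b)-1$. Then $$|N_k(g)\setminus S_k(g)| = |N_{k+1}(g)|.$$
   Context: All lattice paths take steps in $\{(1,0),(0,1)\}$. The points of a path starting at $(x,y)$ are the lattice points visited, including its startpoint and endpoint. The boundary of a path is the line segment joining its startpoint to its endpoint. A flaw of a path is a point of the path lying strictly above its boundary. $N(g)$ is the set of all such paths from $(0,0)$ to $(ga,gb)$. $N_k(g)\subseteq N(g)$ is the set of those with exactly $k$ flaws; the possible values are $0\le k<g(a+b)$. A path in $N(g)$ has max flaws if it has $g(a+b)-1$ flaws. For paths $p_1,p_2$, the concatenation $p_1p_2$ starts at the startpoint of $p_1$, takes the steps of $p_1$ in order and then the steps of $p_2$ in order. For $0\le k<g(a+b)-1$, $S_k(g)$ is the set of paths in $N_k(g)$ of the form $p_1p_2$, where for some $j$ with $0<j<g$ we have $p_1\in N_0(g-j)$ and $p_2\in N_k(j)$, and $p_2$ has max flaws (that is, $k=j(a+b)-1$). -}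

module Defs where

open import Data.Nat using (ℕ; zero; suc; _+_; _*_; _∸_; _≡ᵇ_; _<ᵇ_)
open import Data.Bool using (Bool; true; false; _∧_; _∨_; not)
open import Data.List using (List; []; _∷_; map; _++_; length; filterᵇ; take; drop; upTo; concatMap)
open import Data.Product using (_×_; _,_; proj₁; proj₂)
open import Data.Bool.ListAction using (any)

-- Unit steps: E = (1,0), N = (0,1).  A lattice path starting at (0,0)
-- is represented by its list of steps.
data Step : Set where
  E N : Step

allSeqs : ℕ → List (List Step)
allSeqs zero    = [] ∷ []
allSeqs (suc n) = map (E ∷_) (allSeqs n) ++ map (N ∷_) (allSeqs n)

move : ℕ × ℕ → Step → ℕ × ℕ
move (x , y) E = (suc x , y)
move (x , y) N = (x , suc y)

pointsFrom : ℕ × ℕ → List Step → List (ℕ × ℕ)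
pointsFrom q []       = q ∷ []
pointsFrom q (s ∷ ss) = q ∷ pointsFrom (move q s) ss

endpt : List Step → ℕ × ℕ
endpt []       = (0 , 0)
endpt (s ∷ ss) = move' s (endpt ss)
  where
  move' : Step → ℕ × ℕ → ℕ × ℕ
  move' E (x , y) = (suc x , y)
  move' N (x , y) = (x , suc y)

-- (x,y) lies strictly above the segment from (0,0) to (X,Y) (X > 0):
-- y > x Y / X, i.e. x*Y < y*X
strictlyAbove : ℕ × ℕ → ℕ × ℕ → Bool
strictlyAbove (X , Y) (x , y) = (x * Y) <ᵇ (y * X)

-- number of flaws of a path (relative to its own boundary);
-- flaws are invariant under translation, so we start at (0,0)
flaws : List Step → ℕ
flaws p = length (filterᵇ (strictlyAbove (endpt p)) (pointsFrom (0 , 0) p))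

inN : ℕ → ℕ → ℕ → List Step → Bool
inN a b g p = (proj₁ (endpt p) ≡ᵇ g * a) ∧ (proj₂ (endpt p) ≡ᵇ g * b)

Nset : ℕ → ℕ → ℕ → List (List Step)
Nset a b g = filterᵇ (inN a b g) (allSeqs (g * a + g * b))

inNk : ℕ → ℕ → ℕ → ℕ → List Step → Bool
inNk a b g k p = inN a b g p ∧ (flaws p ≡ᵇ k)

Nkset : ℕ → ℕ → ℕ → ℕ → List (List Step)
Nkset a b g k = filterᵇ (λ p → flaws p ≡ᵇ k) (Nset a b g)

-- membership in S_k(g): p = p1 p2 with p1 ∈ N_0(g-j), p2 ∈ N_k(j),
-- 0 < j < g, and p2 has max flaws, i.e. k = j(a+b) - 1 (k + 1 = j(a+b)).
inS : ℕ → ℕ → ℕ → ℕ → List Step → Bool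
inS a b g k p =
  inNk a b g k p ∧
  any (λ j → not (j ≡ᵇ 0)
             ∧ (suc k ≡ᵇ j * (a + b))
             ∧ any (λ i → inNk a b (g ∸ j) 0 (take i p) ∧ inNk a b j k (drop i p))
                   (upTo (suc (length p))))
      (upTo g)

Sset : ℕ → ℕ → ℕ → ℕ → List (List Step)
Sset a b g k = filterᵇ (inS a b g k) (Nkset a b g k)

NkMinusSk : ℕ → ℕ → ℕ → ℕ → List (List Step)
NkMinusSk a b g k = filterᵇ (λ p → not (inS a b g k p)) (Nkset a b g k)

-- Give the point (x , y) the height y a − x b. A path in N(g) starts and ends at height 0, and its
-- flaws are exactly its points of positive height. Coprimality makes every point of height 0 a
-- multiple of (a , b), so membership in S_k(g) can be read off the heights as well.
--
-- Let p have k + 1 flaws, let v be its least positive height and cut p just before its first point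
-- at height v. If p returns to height v later, the loop between the two visits is moved to the end
-- of p; otherwise the block from the last zero before the cut up to the cut is moved to the end.
-- The swapped blocks are shifted by ±v, and as no other height of p lies in the window (0 , v], only
-- the point at height v changes sign: exactly one flaw is lost. The result is never in S_k(g), and
-- p is recovered from it by splitting off its excursion after the last zero and comparing the least
-- positive height before that excursion with the greatest negative height inside it. So the two
-- maps are mutually inverse between N_{k+1}(g) and N_k(g) ∖ S_k(g).

module Submission where

open import Defs
open import Data.Bool using (T; not; true; false; if_then_else_)
open import Data.Bool.Properties using (T?; T-∧)
open import Data.Empty using (⊥-elim)
open import Data.Fin using (Fin)
open import Data.Fin.Properties using (injective⇒≤)
open import Data.Integer as ℤ using (ℤ; 0ℤ)
import Data.Integer.Properties as ℤP
open import Algebra.Properties.AbelianGroup ℤP.+-0-abelianGroup using (\\-leftDividesˡ; \\-leftDividesʳ)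
open import Data.Integer.Solver using (module +-*-Solver)
open import Data.List using (List; []; _∷_; _++_; _∷ʳ_; map; length; lookup; filter; filterᵇ; take; drop; upTo)
open import Data.List.Membership.Propositional using (_∈_; find; lose)
open import Data.List.Membership.Propositional.Properties
  using (∈-lookup; ∈-filter⁺; ∈-filter⁻; ∈-map⁺; ∈-map⁻; ∈-++⁺ˡ; ∈-++⁺ʳ; ∈-upTo⁺; ∈-upTo⁻)
open import Data.List.Properties
  using (length-++; filter-++; filter-accept; filter-reject; filter-none; filter-all; filter-complete; filter-some;
         ++-assoc; ∷-injectiveʳ; take++drop≡id)
open import Data.List.Relation.Unary.All as All using (All; []; _∷_)
import Data.List.Relation.Unary.All.Properties as AllP
open import Data.List.Relation.Unary.AllPairs using ([]; _∷_)
open import Data.List.Relation.Unary.Any as Any using (here; there)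
open import Data.List.Relation.Unary.Any.Properties using (lookup-index; any⁺; any⁻)
open import Data.List.Relation.Unary.Unique.Propositional using (Unique)
import Data.List.Relation.Unary.Unique.Propositional.Properties as Unique
open import Data.Maybe using (Maybe; just; nothing)
open import Data.Nat as ℕ using (ℕ; zero; suc; _*_; _∸_; _≡ᵇ_)
import Data.Nat.Properties as NP
open import Data.Nat.Coprimality using (Coprime; coprime-divisor)
open import Data.Nat.Divisibility using (divides)
open import Data.Nat.Solver using () renaming (module +-*-Solver to ℕ-Solver)
open import Data.Product using (_×_; _,_; proj₁; proj₂; ∃)
open import Data.Product.Properties using (×-≡,≡→≡)
open import Data.Sum using (_⊎_; inj₁; inj₂)
open import Function using (_⇔_; mk⇔; Equivalence; _∘_; _∘′_)
open import Function.Construct.Symmetry using (⇔-sym)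
open Equivalence using (to; from)
open import Level using (0ℓ)
open import Relation.Binary using (Rel; IsDecTotalOrder)
open import Relation.Binary.PropositionalEquality
open import Relation.Binary.Properties.DecTotalOrder ℤP.≤-decTotalOrder using (≥-isDecTotalOrder)
open import Relation.Nullary using (yes; no; ¬_; does; contradiction)
open import Relation.Nullary.Decidable using (dec-false; dec-true)
open import Relation.Unary using (Pred; Decidable; ∁)

Unique⇒lookup-injective : ∀ {A : Set} {xs : List A} → Unique xs →
  ∀ i j → lookup xs i ≡ lookup xs j → i ≡ j
Unique⇒lookup-injective (_ ∷ _)  Fin.zero    Fin.zero    _  = refl
Unique⇒lookup-injective (x∉ ∷ _) Fin.zero    (Fin.suc j) eq = ⊥-elim (All.lookup x∉ (∈-lookup j) eq)
Unique⇒lookup-injective (x∉ ∷ _) (Fin.suc i) Fin.zero    eq = ⊥-elim (All.lookup x∉ (∈-lookup i) (sym eq))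
Unique⇒lookup-injective (_ ∷ u)  (Fin.suc i) (Fin.suc j) eq = cong Fin.suc (Unique⇒lookup-injective u i j eq)

injectiveOn⇒length≤ : ∀ {A B : Set} {xs : List A} {ys : List B} → Unique xs → (f : A → B) →
  (∀ {x} → x ∈ xs → f x ∈ ys) → (∀ {x y} → x ∈ xs → y ∈ xs → f x ≡ f y → x ≡ y) →
  length xs ℕ.≤ length ys
injectiveOn⇒length≤ {xs = xs} {ys} unique f into injective = injective⇒≤ index-injective
  where
  index : Fin (length xs) → Fin (length ys)
  index i = Any.index (into (∈-lookup i))
  index-injective : ∀ {i j} → index i ≡ index j → i ≡ j
  index-injective {i} {j} eq = Unique⇒lookup-injective unique i j (injective (∈-lookup i) (∈-lookup j) (begin
    f (lookup xs i)     ≡⟨ lookup-index (into (∈-lookup i)) ⟩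
    lookup ys (index i) ≡⟨ cong (lookup ys) eq ⟩
    lookup ys (index j) ≡⟨ lookup-index (into (∈-lookup j)) ⟨
    f (lookup xs j)     ∎))
    where open ≡-Reasoning

inverseOn⇒length≡ : ∀ {A B : Set} {xs : List A} {ys : List B} → Unique xs → Unique ys →
  (f : A → B) (g : B → A) → (∀ {x} → x ∈ xs → f x ∈ ys) → (∀ {y} → y ∈ ys → g y ∈ xs) →
  (∀ {x} → x ∈ xs → g (f x) ≡ x) → (∀ {y} → y ∈ ys → f (g y) ≡ y) → length xs ≡ length ys
inverseOn⇒length≡ xs-unique ys-unique f g f-into g-into g∘f f∘g = NP.≤-antisym
  (injectiveOn⇒length≤ xs-unique f f-into λ x∈ y∈ eq → trans (sym (g∘f x∈)) (trans (cong g eq) (g∘f y∈)))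
  (injectiveOn⇒length≤ ys-unique g g-into λ x∈ y∈ eq → trans (sym (f∘g x∈)) (trans (cong f eq) (f∘g y∈)))

take-length-++ : ∀ {A : Set} (xs ys : List A) → take (length xs) (xs ++ ys) ≡ xs
take-length-++ []       ys = refl
take-length-++ (x ∷ xs) ys = cong (x ∷_) (take-length-++ xs ys)

drop-length-++ : ∀ {A : Set} (xs ys : List A) → drop (length xs) (xs ++ ys) ≡ ys
drop-length-++ []       ys = refl
drop-length-++ (x ∷ xs) ys = drop-length-++ xs ys

module Least {A : Set} {P : Pred A 0ℓ} (P? : Decidable P)
             {_≼_ : Rel A 0ℓ} (≼-isDecTotalOrder : IsDecTotalOrder _≡_ _≼_) where

  open IsDecTotalOrder ≼-isDecTotalOrder using ()
    renaming (_≤?_ to _≼?_; total to ≼-total; antisym to ≼-antisym; trans to ≼-trans; refl to ≼-refl)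

  least : List A → Maybe A
  least []       = nothing
  least (x ∷ xs) with P? x | least xs
  ... | no _  | m       = m
  ... | yes _ | nothing = just x
  ... | yes _ | just m with x ≼? m
  ...   | yes _ = just x
  ...   | no _  = just m

  IsLeast : A → List A → Set
  IsLeast v xs = P v × v ∈ xs × All (λ x → P x → v ≼ x) xs

  data LeastView (xs : List A) : Maybe A → Set where
    none : All (∁ P) xs → LeastView xs nothing
    some : ∀ {v} → IsLeast v xs → LeastView xs (just v)

  least-view : ∀ xs → LeastView xs (least xs)
  least-view []       = none []
  least-view (x ∷ xs) with P? x | least xs | least-view xs
  ... | no ¬px | _       | none ¬ps = none (¬px ∷ ¬ps)
  ... | no ¬px | _       | some (pv , v∈ , v≼) =
    some (pv , there v∈ , (λ px → contradiction px ¬px) ∷ v≼)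
  ... | yes px | nothing | none ¬ps =
    some (px , here refl , (λ _ → ≼-refl) ∷ All.map (λ ¬p p → contradiction p ¬p) ¬ps)
  ... | yes px | just m  | some (pm , m∈ , m≼) with x ≼? m
  ...   | yes x≼m = some (px , here refl , (λ _ → ≼-refl) ∷ All.map (λ m≼y → ≼-trans x≼m ∘′ m≼y) m≼)
  ...   | no x⋠m  = some (pm , there m∈ , (λ _ → m≼x) ∷ m≼)
    where
    m≼x : m ≼ x
    m≼x with ≼-total x m
    ... | inj₁ x≼m = contradiction x≼m x⋠m
    ... | inj₂ m≼x = m≼x

  least-nothing : ∀ {xs} → least xs ≡ nothing → All (∁ P) xs
  least-nothing {xs} eq with none ¬ps ← subst (LeastView xs) eq (least-view xs) = ¬ps

  least-just : ∀ {xs v} → least xs ≡ just v → IsLeast v xs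
  least-just {xs} eq with some isLeast ← subst (LeastView xs) eq (least-view xs) = isLeast

  IsLeast-unique : ∀ {xs v w} → IsLeast v xs → IsLeast w xs → v ≡ w
  IsLeast-unique (pv , v∈ , v≼) (pw , w∈ , w≼) = ≼-antisym (All.lookup v≼ w∈ pw) (All.lookup w≼ v∈ pv)

  least-complete : ∀ {xs v} → IsLeast v xs → least xs ≡ just v
  least-complete {xs} isLeast with least xs | least-view xs
  ... | nothing | none ¬ps = contradiction (proj₁ isLeast) (All.lookup ¬ps (proj₁ (proj₂ isLeast)))
  ... | just w  | some isLeast′ = cong just (IsLeast-unique isLeast′ isLeast)

  least-none : ∀ {xs} → All (∁ P) xs → least xs ≡ nothing
  least-none {xs} ¬ps with least xs | least-view xs
  ... | nothing | _ = refl
  ... | just _  | some (pv , v∈ , _) = contradiction pv (All.lookup ¬ps v∈)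

length-filter-map : ∀ {A B : Set} {P : Pred A 0ℓ} {Q : Pred B 0ℓ} (P? : Decidable P) (Q? : Decidable Q)
  {f : A → B} {xs} → All (λ x → Q (f x) ⇔ P x) xs → length (filter Q? (map f xs)) ≡ length (filter P? xs)
length-filter-map P? Q? [] = refl
length-filter-map P? Q? {f} {x ∷ xs} (Qfx⇔Px ∷ rest) with P? x | Q? (f x)
... | yes _  | yes _  = cong suc (length-filter-map P? Q? rest)
... | no _   | no _   = length-filter-map P? Q? rest
... | yes px | no ¬q  = contradiction (from Qfx⇔Px px) ¬q
... | no ¬px | yes q  = contradiction (to Qfx⇔Px q) ¬px

module HeightArithmetic where

  open import Data.Integer using (-_; _+_; _≤_; _<_)

  -v+[v+x]≡x : ∀ v x → - v + (v + x) ≡ x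
  -v+[v+x]≡x = \\-leftDividesʳ

  v+[-v+x]≡x : ∀ v x → v + (- v + x) ≡ x
  v+[-v+x]≡x = \\-leftDividesˡ

  x≢0⇒d+x≢d : ∀ d {x} → x ≢ 0ℤ → d + x ≢ d
  x≢0⇒d+x≢d d {x} x≢0 eq = x≢0 (trans (sym (-v+[v+x]≡x d x)) (trans (cong (- d +_) eq) (ℤP.+-inverseˡ d)))

  x≢w⇒-w+x≢0 : ∀ {w x} → x ≢ w → - w + x ≢ 0ℤ
  x≢w⇒-w+x≢0 {w} {x} x≢w eq = x≢w (trans (sym (v+[-v+x]≡x w x)) (trans (cong (w +_) eq) (ℤP.+-identityʳ w)))

  v<y⇒0<-v+y : ∀ {v y} → v < y → 0ℤ < - v + y
  v<y⇒0<-v+y {v} {y} v<y = subst (_< - v + y) (ℤP.+-inverseˡ v) (ℤP.+-monoʳ-< (- v) v<y)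

  0<-v+y⇒v<y : ∀ {v y} → 0ℤ < - v + y → v < y
  0<-v+y⇒v<y {v} {y} 0<-v+y = subst₂ _<_ (ℤP.+-identityʳ v) (v+[-v+x]≡x v y) (ℤP.+-monoʳ-< v 0<-v+y)

  -w<v⇒0<w+v : ∀ {v w} → - w < v → 0ℤ < w + v
  -w<v⇒0<w+v {v} {w} -w<v = subst (_< w + v) (ℤP.+-inverseʳ w) (ℤP.+-monoʳ-< w -w<v)

  0<w+v⇒-w<v : ∀ {v w} → 0ℤ < w + v → - w < v
  0<w+v⇒-w<v {v} {w} 0<w+v = subst₂ _<_ (ℤP.+-identityʳ (- w)) (-v+[v+x]≡x w v) (ℤP.+-monoʳ-< (- w) 0<w+v)

  w≤-v⇒w+v≤0 : ∀ {v w} → w ≤ - v → w + v ≤ 0ℤ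
  w≤-v⇒w+v≤0 {v} {w} w≤-v = subst (w + v ≤_) (ℤP.+-inverseˡ v) (ℤP.+-monoˡ-≤ v w≤-v)

  w+v≤0⇒w≤-v : ∀ {v w} → w + v ≤ 0ℤ → w ≤ - v
  w+v≤0⇒w≤-v {v} {w} w+v≤0 = subst₂ _≤_ w+v-v≡w (ℤP.+-identityˡ (- v)) (ℤP.+-monoˡ-≤ (- v) w+v≤0)
    where
    w+v-v≡w : w + v + - v ≡ w
    w+v-v≡w = trans (ℤP.+-assoc w v (- v)) (trans (cong (w +_) (ℤP.+-inverseʳ v)) (ℤP.+-identityʳ w))

  positives : List ℤ → ℕ
  positives xs = length (filter (0ℤ ℤP.<?_) xs)

  positives-++ : ∀ xs ys → positives (xs ++ ys) ≡ positives xs ℕ.+ positives ys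
  positives-++ xs ys = trans (cong length (filter-++ (0ℤ ℤP.<?_) xs ys)) (length-++ (filter (0ℤ ℤP.<?_) xs))

  positives-map : ∀ {f xs} → All (λ x → 0ℤ < f x ⇔ 0ℤ < x) xs → positives (map f xs) ≡ positives xs
  positives-map = length-filter-map (0ℤ ℤP.<?_) (0ℤ ℤP.<?_)

  positives-∷-pos : ∀ {x} xs → 0ℤ < x → positives (x ∷ xs) ≡ suc (positives xs)
  positives-∷-pos xs 0<x = cong length (filter-accept (0ℤ ℤP.<?_) 0<x)

  positives-∷-nonpos : ∀ {x} xs → x ≤ 0ℤ → positives (x ∷ xs) ≡ positives xs
  positives-∷-nonpos xs x≤0 = cong length (filter-reject (0ℤ ℤP.<?_) (ℤP.≤⇒≯ x≤0))

  positives-none : ∀ {xs} → All (λ x → ¬ 0ℤ < x) xs → positives xs ≡ 0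
  positives-none none = cong length (filter-none (0ℤ ℤP.<?_) none)

  positives≡0⇒nonpos : ∀ xs → positives xs ≡ 0 → All (_≤ 0ℤ) xs
  positives≡0⇒nonpos xs eq = All.tabulate λ x∈ → ℤP.≮⇒≥ λ 0<x →
    NP.<⇒≢ (filter-some (0ℤ ℤP.<?_) (lose x∈ 0<x)) (sym eq)

  positives-all : ∀ {xs} → All (0ℤ <_) xs → positives xs ≡ length xs
  positives-all all = cong length (filter-all (0ℤ ℤP.<?_) all)

  positives≡length⇒pos : ∀ xs → positives xs ≡ length xs → All (0ℤ <_) xs
  positives≡length⇒pos xs eq =
    subst (All (0ℤ <_)) (filter-complete (0ℤ ℤP.<?_) eq) (AllP.all-filter (0ℤ ℤP.<?_) xs)

  positives-swap : ∀ xs ys zs ys′ zs′ →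
    positives ys ℕ.+ positives zs ≡ suc (positives ys′ ℕ.+ positives zs′) →
    positives (xs ++ ys ++ zs) ≡ suc (positives (xs ++ zs′ ++ ys′))
  positives-swap xs ys zs ys′ zs′ eq = begin
    positives (xs ++ ys ++ zs)                    ≡⟨ positives-++ xs (ys ++ zs) ⟩
    positives xs ℕ.+ positives (ys ++ zs)         ≡⟨ cong (positives xs ℕ.+_) (trans (positives-++ ys zs) eq) ⟩
    positives xs ℕ.+ suc (positives ys′ ℕ.+ positives zs′)
      ≡⟨ cong (λ n → positives xs ℕ.+ suc n) (NP.+-comm (positives ys′) _) ⟩
    positives xs ℕ.+ suc (positives zs′ ℕ.+ positives ys′)
      ≡⟨ cong (λ n → positives xs ℕ.+ suc n) (positives-++ zs′ ys′) ⟨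
    positives xs ℕ.+ suc (positives (zs′ ++ ys′)) ≡⟨ NP.+-suc (positives xs) _ ⟩
    suc (positives xs ℕ.+ positives (zs′ ++ ys′)) ≡⟨ cong suc (positives-++ xs (zs′ ++ ys′)) ⟨
    suc (positives (xs ++ zs′ ++ ys′))            ∎
    where open ≡-Reasoning

  OutsideWindow : ℤ → ℤ → Set
  OutsideWindow v y = y ≤ 0ℤ ⊎ v < y

  min⇒outside : ∀ {v y} → (0ℤ < y → v ≤ y) → y ≢ v → OutsideWindow v y
  min⇒outside {v} {y} least y≢v with 0ℤ ℤP.<? y
  ... | yes 0<y = inj₂ (ℤP.≤∧≢⇒< (least 0<y) (y≢v ∘′ sym))
  ... | no 0≮y  = inj₁ (ℤP.≮⇒≥ 0≮y)

  >⇒outside : ∀ {v y} → (0ℤ < y → v < y) → OutsideWindow v y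
  >⇒outside {v} {y} above with 0ℤ ℤP.<? y
  ... | yes 0<y = inj₂ (above 0<y)
  ... | no 0≮y  = inj₁ (ℤP.≮⇒≥ 0≮y)

  outside⇒≢ : ∀ {v y} → 0ℤ < v → OutsideWindow v y → y ≢ v
  outside⇒≢ 0<v (inj₁ y≤0) refl = ℤP.<⇒≱ 0<v y≤0
  outside⇒≢ _   (inj₂ v<y) refl = ℤP.<-irrefl refl v<y

  outside⇒> : ∀ {v y} → OutsideWindow v y → 0ℤ < y → v < y
  outside⇒> (inj₁ y≤0) 0<y = contradiction 0<y (ℤP.≤⇒≯ y≤0)
  outside⇒> (inj₂ v<y) _   = v<y

  outside-shift-down-sign : ∀ {v y} → 0ℤ < v → OutsideWindow v y → (0ℤ < - v + y ⇔ 0ℤ < y)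
  outside-shift-down-sign 0<v out =
    mk⇔ (λ 0<-v+y → ℤP.<-trans 0<v (0<-v+y⇒v<y 0<-v+y)) (λ 0<y → v<y⇒0<-v+y (outside⇒> out 0<y))

  outside-shift-down-≢0 : ∀ {v y} → 0ℤ < v → OutsideWindow v y → - v + y ≢ 0ℤ
  outside-shift-down-≢0 {v} {y} 0<v out eq =
    outside⇒≢ 0<v out (trans (sym (v+[-v+x]≡x v y)) (trans (cong (v +_) eq) (ℤP.+-identityʳ v)))

  outside-shift-down-≤ : ∀ {v y} → OutsideWindow v y → - v + y < 0ℤ → - v + y ≤ - v
  outside-shift-down-≤ {v} (inj₁ y≤0) _ =
    subst (- v + _ ≤_) (ℤP.+-identityʳ (- v)) (ℤP.+-monoʳ-≤ (- v) y≤0)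
  outside-shift-down-≤     (inj₂ v<y) neg = contradiction (v<y⇒0<-v+y v<y) (ℤP.<-asym neg)

  outside-shift-up : ∀ {V x} → (x < 0ℤ → x ≤ - V) → x ≢ 0ℤ → OutsideWindow V (V + x)
  outside-shift-up {V} {x} below x≢0 with x ℤP.<? 0ℤ
  ... | yes x<0 = inj₁ (subst (V + x ≤_) (ℤP.+-inverseʳ V) (ℤP.+-monoʳ-≤ V (below x<0)))
  ... | no x≮0  = inj₂ (subst (_< V + x) (ℤP.+-identityʳ V)
                          (ℤP.+-monoʳ-< V (ℤP.≤∧≢⇒< (ℤP.≮⇒≥ x≮0) (x≢0 ∘′ sym))))

  outside-shift-up-sign : ∀ {V x} → 0ℤ < V → OutsideWindow V (V + x) → (0ℤ < V + x ⇔ 0ℤ < x)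
  outside-shift-up-sign {V} {x} 0<V out =
    ⇔-sym (subst (λ y → 0ℤ < y ⇔ 0ℤ < V + x) (-v+[v+x]≡x V x) (outside-shift-down-sign 0<V out))

  positives-shift-down : ∀ {v} ys → 0ℤ < v → All (OutsideWindow v) ys →
    positives (map (- v +_) ys) ≡ positives ys
  positives-shift-down _ 0<v outs = positives-map (All.map (outside-shift-down-sign 0<v) outs)

  positives-shift-up : ∀ {V} xs → 0ℤ < V → All (λ x → OutsideWindow V (V + x)) xs →
    positives (map (V +_) xs) ≡ positives xs
  positives-shift-up _ 0<V outs = positives-map (All.map (outside-shift-up-sign 0<V) outs)

open HeightArithmetic

module Heights (a b : ℕ) where

  open import Data.Integer using (-_; _+_; _≤_; _<_)

  δ : Step → ℤ
  δ E = - ℤ.+ b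
  δ N = ℤ.+ a

  heights : ℤ → List Step → List ℤ
  heights h []       = []
  heights h (s ∷ ss) = h ∷ heights (h + δ s) ss

  endHeight : ℤ → List Step → ℤ
  endHeight h []       = h
  endHeight h (s ∷ ss) = endHeight (h + δ s) ss

  length-heights : ∀ h p → length (heights h p) ≡ length p
  length-heights h []       = refl
  length-heights h (s ∷ ss) = cong suc (length-heights (h + δ s) ss)

  heights-++ : ∀ h {α} A B → endHeight h A ≡ α → heights h (A ++ B) ≡ heights h A ++ heights α B
  heights-++ h []      B refl = refl
  heights-++ h (s ∷ A) B eq   = cong (h ∷_) (heights-++ (h + δ s) A B eq)

  endHeight-++ : ∀ h {α} A B → endHeight h A ≡ α → endHeight h (A ++ B) ≡ endHeight α B
  endHeight-++ h []      B refl = refl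
  endHeight-++ h (s ∷ A) B eq   = endHeight-++ (h + δ s) A B eq

  heights-shift : ∀ d h p → heights (d + h) p ≡ map (d +_) (heights h p)
  heights-shift d h []       = refl
  heights-shift d h (s ∷ ss) = cong ((d + h) ∷_)
    (trans (cong (λ h′ → heights h′ ss) (ℤP.+-assoc d h (δ s))) (heights-shift d (h + δ s) ss))

  endHeight-shift : ∀ d h p → endHeight (d + h) p ≡ d + endHeight h p
  endHeight-shift d h []       = refl
  endHeight-shift d h (s ∷ ss) =
    trans (cong (λ h′ → endHeight h′ ss) (ℤP.+-assoc d h (δ s))) (endHeight-shift d (h + δ s) ss)

  heights-rebase : ∀ {h h′} d p → h′ ≡ d + h → heights h′ p ≡ map (d +_) (heights h p)
  heights-rebase {h} d p refl = heights-shift d h p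

  endHeight-rebase : ∀ {h h′} d p → h′ ≡ d + h → endHeight h′ p ≡ d + endHeight h p
  endHeight-rebase {h} d p refl = endHeight-shift d h p

  0+δs≡-v+[v+δs] : ∀ v s → 0ℤ + δ s ≡ - v + (v + δ s)
  0+δs≡-v+[v+δs] v s = trans (ℤP.+-identityˡ (δ s)) (sym (-v+[v+x]≡x v (δ s)))

  FirstReach : ℤ → ℤ → List Step → Set
  FirstReach c h A = All (_≢ c) (heights h A) × endHeight h A ≡ c

  firstVisit : ℤ → ℤ → List Step → Maybe (List Step × Step × List Step)
  firstVisit c h []       = nothing
  firstVisit c h (s ∷ ss) with h ℤ.≟ c
  ... | yes _ = just ([] , s , ss)
  ... | no _ with firstVisit c (h + δ s) ss
  ...   | just (A , r , R) = just (s ∷ A , r , R)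
  ...   | nothing          = nothing

  firstVisit-just : ∀ {c h} p {A r R} → firstVisit c h p ≡ just (A , r , R) →
    p ≡ A ++ r ∷ R × FirstReach c h A
  firstVisit-just {c} {h} (s ∷ ss) eq with h ℤ.≟ c
  firstVisit-just (s ∷ ss) refl | yes h≡c = refl , [] , h≡c
  ... | no h≢c with firstVisit c (h + δ s) ss in eq′
  firstVisit-just (s ∷ ss) refl | no h≢c | just _
    with refl , avoids , reaches ← firstVisit-just ss eq′ = refl , h≢c ∷ avoids , reaches

  firstVisit-nothing : ∀ {c h} p → firstVisit c h p ≡ nothing → All (_≢ c) (heights h p)
  firstVisit-nothing []       _ = []
  firstVisit-nothing {c} {h} (s ∷ ss) eq with h ℤ.≟ c
  ... | no h≢c with firstVisit c (h + δ s) ss in eq′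
  firstVisit-nothing (s ∷ ss) refl | no h≢c | nothing = h≢c ∷ firstVisit-nothing ss eq′

  firstVisit-complete : ∀ {c h} A r R → FirstReach c h A → firstVisit c h (A ++ r ∷ R) ≡ just (A , r , R)
  firstVisit-complete {c} {h} [] r R (_ , h≡c) with h ℤ.≟ c
  ... | yes _   = refl
  ... | no h≢c = ⊥-elim (h≢c h≡c)
  firstVisit-complete {c} {h} (s ∷ A) r R (h≢c ∷ avoids , reaches) with h ℤ.≟ c
  ... | yes h≡c = ⊥-elim (h≢c h≡c)
  ... | no _ rewrite firstVisit-complete A r R (avoids , reaches) = refl

  firstVisit-avoid : ∀ {c h} p → All (_≢ c) (heights h p) → firstVisit c h p ≡ nothing
  firstVisit-avoid []       [] = refl
  firstVisit-avoid {c} {h} (s ∷ ss) (h≢c ∷ avoids) with h ℤ.≟ c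
  ... | yes h≡c = ⊥-elim (h≢c h≡c)
  ... | no _ rewrite firstVisit-avoid ss avoids = refl

  lastVisit : ℤ → ℤ → List Step → Maybe (List Step × Step × List Step)
  lastVisit c h []       = nothing
  lastVisit c h (s ∷ ss) with lastVisit c (h + δ s) ss
  ... | just (U , t , T) = just (s ∷ U , t , T)
  ... | nothing with h ℤ.≟ c
  ...   | yes _ = just ([] , s , ss)
  ...   | no _  = nothing

  LastLeave : ℤ → ℤ → List Step → Step → List Step → Set
  LastLeave c h U t T = endHeight h U ≡ c × All (_≢ c) (heights (c + δ t) T)

  lastVisit-nothing : ∀ {c h} p → lastVisit c h p ≡ nothing → All (_≢ c) (heights h p)
  lastVisit-nothing [] _ = []
  lastVisit-nothing {c} {h} (s ∷ ss) eq with lastVisit c (h + δ s) ss in eq′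
  ... | nothing with h ℤ.≟ c
  lastVisit-nothing (s ∷ ss) refl | nothing | no h≢c = h≢c ∷ lastVisit-nothing ss eq′

  lastVisit-just : ∀ {c h} p {U t T} → lastVisit c h p ≡ just (U , t , T) →
    p ≡ U ++ t ∷ T × LastLeave c h U t T
  lastVisit-just {c} {h} (s ∷ ss) eq with lastVisit c (h + δ s) ss in eq′
  lastVisit-just (s ∷ ss) refl | just _
    with refl , reaches , avoids ← lastVisit-just ss eq′ = refl , reaches , avoids
  ... | nothing with h ℤ.≟ c
  lastVisit-just (s ∷ ss) refl | nothing | yes refl = refl , refl , lastVisit-nothing ss eq′

  lastVisit-avoid : ∀ {c h} p → All (_≢ c) (heights h p) → lastVisit c h p ≡ nothing
  lastVisit-avoid [] [] = refl
  lastVisit-avoid {c} {h} (s ∷ ss) (h≢c ∷ avoids) rewrite lastVisit-avoid ss avoids with h ℤ.≟ c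
  ... | yes h≡c = ⊥-elim (h≢c h≡c)
  ... | no _    = refl

  lastVisit-complete : ∀ {c h} U t T → LastLeave c h U t T → lastVisit c h (U ++ t ∷ T) ≡ just (U , t , T)
  lastVisit-complete {h = h} [] t T (refl , avoids) rewrite lastVisit-avoid T avoids with h ℤ.≟ h
  ... | yes _   = refl
  ... | no h≢h = ⊥-elim (h≢h refl)
  lastVisit-complete (u ∷ U) t T leave rewrite lastVisit-complete U t T leave = refl

module MinPositive = Least (0ℤ ℤP.<?_) ℤP.≤-isDecTotalOrder
module MaxNegative = Least (ℤP._<? 0ℤ) ≥-isDecTotalOrder

open MinPositive using () renaming
  (least to minPositive; IsLeast to IsMinPositive; least-nothing to minPositive-nothing;
   least-just to minPositive-just; least-complete to minPositive-complete; least-none to minPositive-none)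
open MaxNegative using () renaming
  (least to maxNegative; IsLeast to IsMaxNegative; least-nothing to maxNegative-nothing;
   least-just to maxNegative-just; least-complete to maxNegative-complete; least-none to maxNegative-none)

data BlockSwap : List Step → List Step → Set where
  swap : ∀ A B C → BlockSwap (A ++ B ++ C) (A ++ C ++ B)

endpt-++ : ∀ xs ys →
  endpt (xs ++ ys) ≡ (proj₁ (endpt xs) ℕ.+ proj₁ (endpt ys) , proj₂ (endpt xs) ℕ.+ proj₂ (endpt ys))
endpt-++ []       ys = refl
endpt-++ (E ∷ xs) ys = cong (λ q → suc (proj₁ q) , proj₂ q) (endpt-++ xs ys)
endpt-++ (N ∷ xs) ys = cong (λ q → proj₁ q , suc (proj₂ q)) (endpt-++ xs ys)

endpt-swap : ∀ {p q} → BlockSwap p q → endpt p ≡ endpt q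
endpt-swap (swap A B C)
  rewrite endpt-++ A (B ++ C) | endpt-++ A (C ++ B) | endpt-++ B C | endpt-++ C B
        | NP.+-comm (proj₁ (endpt B)) (proj₁ (endpt C)) | NP.+-comm (proj₂ (endpt B)) (proj₂ (endpt C)) = refl

length≡x+y : ∀ p → length p ≡ proj₁ (endpt p) ℕ.+ proj₂ (endpt p)
length≡x+y []      = refl
length≡x+y (E ∷ p) = cong suc (length≡x+y p)
length≡x+y (N ∷ p) = trans (cong suc (length≡x+y p)) (sym (NP.+-suc _ _))

module LowerRaise (a b : ℕ) where

  open import Data.Integer using (-_; _+_; _≤_; _<_)
  open Heights a b

  OneFlawLess : List Step → List Step → Set
  OneFlawLess p q = positives (heights 0ℤ p) ≡ suc (positives (heights 0ℤ q))

  record Exchange (p q : List Step) : Set where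
    constructor exchange
    field
      blocks        : BlockSwap p q
      one-flaw-less : OneFlawLess p q

  oneFlawLess-by-blocks : ∀ {p q} xs ys zs ys′ zs′ →
    heights 0ℤ p ≡ xs ++ ys ++ zs → heights 0ℤ q ≡ xs ++ zs′ ++ ys′ →
    positives ys ℕ.+ positives zs ≡ suc (positives ys′ ℕ.+ positives zs′) → OneFlawLess p q
  oneFlawLess-by-blocks xs ys zs ys′ zs′ hp hq eq =
    subst₂ (λ hp hq → positives hp ≡ suc (positives hq)) (sym hp) (sym hq) (positives-swap xs ys zs ys′ zs′ eq)

  -- Membership in S_k(g), read off the heights.
  data Split : List Step → Set where
    split : ∀ U s ss → endHeight 0ℤ U ≡ 0ℤ → All (_≤ 0ℤ) (heights 0ℤ U) →
            All (0ℤ <_) (heights (0ℤ + δ s) ss) → Split (U ++ s ∷ ss)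

  lower : List Step → List Step
  lower p with minPositive (heights 0ℤ p)
  ... | nothing = p
  ... | just v with firstVisit v 0ℤ p
  ...   | nothing = p
  ...   | just (A , r , R) with firstVisit v (v + δ r) R
  ...     | just (B , c , C) = A ++ (c ∷ C) ++ r ∷ B
  ...     | nothing with lastVisit 0ℤ 0ℤ A
  ...       | just (A₀ , b , B) = A₀ ++ (r ∷ R) ++ b ∷ B
  ...       | nothing = p

  insertLoop : ℤ → List Step → List Step → List Step
  insertLoop v U Y with firstVisit v 0ℤ U
  ... | just (X , z , Z) = X ++ Y ++ z ∷ Z
  ... | nothing          = U ++ Y

  moveBack : ℤ → List Step → List Step → List Step
  moveBack w U Y with lastVisit w 0ℤ Y
  ... | just (Y₁ , t , T) = U ++ (t ∷ T) ++ Y₁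
  ... | nothing           = U ++ Y

  -- 0 < w + v, i.e. - w < v, holds exactly when q came from the second case of lower,
  -- in which - w was the least positive height.
  raiseAfter : List Step → List Step → Maybe ℤ → Maybe ℤ → List Step
  raiseAfter U Y nothing  nothing  = U ++ Y
  raiseAfter U Y (just v) nothing  = insertLoop v U Y
  raiseAfter U Y nothing  (just w) = moveBack w U Y
  raiseAfter U Y (just v) (just w) = if does (0ℤ ℤP.<? w + v) then moveBack w U Y else insertLoop v U Y

  raise : List Step → List Step
  raise q with lastVisit 0ℤ 0ℤ q
  ... | just (U , y , Y) = raiseAfter U (y ∷ Y) (minPositive (heights 0ℤ U)) (maxNegative (heights 0ℤ (y ∷ Y)))
  ... | nothing          = q

  lower-revisit≡ : ∀ p {v A r R B c C} → minPositive (heights 0ℤ p) ≡ just v →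
    firstVisit v 0ℤ p ≡ just (A , r , R) → firstVisit v (v + δ r) R ≡ just (B , c , C) →
    lower p ≡ A ++ (c ∷ C) ++ r ∷ B
  lower-revisit≡ _ m f₁ f₂ rewrite m | f₁ | f₂ = refl

  lower-noRevisit≡ : ∀ p {v A r R A₀ b B} → minPositive (heights 0ℤ p) ≡ just v →
    firstVisit v 0ℤ p ≡ just (A , r , R) → firstVisit v (v + δ r) R ≡ nothing →
    lastVisit 0ℤ 0ℤ A ≡ just (A₀ , b , B) → lower p ≡ A₀ ++ (r ∷ R) ++ b ∷ B
  lower-noRevisit≡ _ m f₁ f₂ l rewrite m | f₁ | f₂ | l = refl

  raise-insertLoop≡ : ∀ q {U y Y v X z Z} → lastVisit 0ℤ 0ℤ q ≡ just (U , y , Y) →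
    minPositive (heights 0ℤ U) ≡ just v → All (λ x → x < 0ℤ → x ≤ - v) (heights 0ℤ (y ∷ Y)) →
    firstVisit v 0ℤ U ≡ just (X , z , Z) → raise q ≡ X ++ (y ∷ Y) ++ z ∷ Z
  raise-insertLoop≡ _ {y = y} {Y} {v} l m below f rewrite l | m with maxNegative (heights 0ℤ (y ∷ Y)) in n
  ... | nothing rewrite f = refl
  ... | just w with w<0 , w∈ , _ ← maxNegative-just n
    rewrite dec-false (0ℤ ℤP.<? w + v) (ℤP.≤⇒≯ (w≤-v⇒w+v≤0 (All.lookup below w∈ w<0))) | f = refl

  raise-moveBack≡ : ∀ q {U y Y w Y₁ t T} → lastVisit 0ℤ 0ℤ q ≡ just (U , y , Y) →
    maxNegative (heights 0ℤ (y ∷ Y)) ≡ just w → All (λ x → 0ℤ < x → - w < x) (heights 0ℤ U) →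
    lastVisit w 0ℤ (y ∷ Y) ≡ just (Y₁ , t , T) → raise q ≡ U ++ (t ∷ T) ++ Y₁
  raise-moveBack≡ _ {U = U} {w = w} l n above f rewrite l | n with minPositive (heights 0ℤ U) in m
  ... | nothing rewrite f = refl
  ... | just v with 0<v , v∈ , _ ← minPositive-just m
    rewrite dec-true (0ℤ ℤP.<? w + v) (-w<v⇒0<w+v (All.lookup above v∈ 0<v)) | f = refl

  raise-split : ∀ {q} → Split q → raise q ≡ q
  raise-split (split U s ss endU flawless full)
    rewrite lastVisit-complete U s ss (endU , All.map (λ 0<x x≡0 → ℤP.<-irrefl (sym x≡0) 0<x) full)
          | minPositive-none (All.map ℤP.≤⇒≯ flawless)
          | maxNegative-none {heights 0ℤ (s ∷ ss)} (ℤP.<-irrefl refl ∷ All.map ℤP.<-asym full) = refl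

  revisit-exchange : ∀ {v} A r B c C → let p = A ++ r ∷ B ++ c ∷ C; q = A ++ (c ∷ C) ++ r ∷ B in
    endHeight 0ℤ p ≡ 0ℤ → IsMinPositive v (heights 0ℤ p) → FirstReach v 0ℤ A → FirstReach v (v + δ r) B →
    Exchange p q × raise q ≡ p
  revisit-exchange {v} A r B c C closed (0<v , _ , least) (A≢v , endA) (B≢v , endB) =
    exchange (swap A (r ∷ B) (c ∷ C)) count , raised
    where
    ys : List ℤ
    ys = heights (v + δ r) B
    hC : List ℤ
    hC = heights v (c ∷ C)
    heights-p : heights 0ℤ (A ++ r ∷ B ++ c ∷ C) ≡ heights 0ℤ A ++ (v ∷ ys) ++ hC
    heights-p = trans (heights-++ 0ℤ A _ endA)
      (cong (λ hs → heights 0ℤ A ++ v ∷ hs) (heights-++ (v + δ r) B _ endB))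
    endC : endHeight v (c ∷ C) ≡ 0ℤ
    endC = trans (sym (trans (endHeight-++ 0ℤ A _ endA) (endHeight-++ (v + δ r) B (c ∷ C) endB))) closed
    heights-loop : heights 0ℤ (r ∷ B) ≡ 0ℤ ∷ map (- v +_) ys
    heights-loop = cong (0ℤ ∷_) (heights-rebase (- v) B (0+δs≡-v+[v+δs] v r))
    heights-q : heights 0ℤ (A ++ (c ∷ C) ++ r ∷ B) ≡ heights 0ℤ A ++ hC ++ (0ℤ ∷ map (- v +_) ys)
    heights-q = trans (heights-++ 0ℤ A _ endA)
      (cong (heights 0ℤ A ++_) (trans (heights-++ v (c ∷ C) (r ∷ B) endC) (cong (hC ++_) heights-loop)))
    least-p : All (λ x → 0ℤ < x → v ≤ x) (heights 0ℤ A ++ (v ∷ ys) ++ hC)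
    least-p = subst (All _) heights-p least
    least-A : All (λ x → 0ℤ < x → v ≤ x) (heights 0ℤ A)
    least-A = AllP.++⁻ˡ (heights 0ℤ A) least-p
    least-ys : All (λ x → 0ℤ < x → v ≤ x) ys
    least-ys = AllP.++⁻ˡ ys (All.tail (AllP.++⁻ʳ (heights 0ℤ A) least-p))
    least-C : All (λ x → 0ℤ < x → v ≤ x) hC
    least-C = AllP.++⁻ʳ ys (All.tail (AllP.++⁻ʳ (heights 0ℤ A) least-p))
    outside : All (OutsideWindow v) ys
    outside = All.zipWith (λ (l , ≢v) → min⇒outside l ≢v) (least-ys , B≢v)
    loop-loses-v : positives (v ∷ ys) ≡ suc (positives (0ℤ ∷ map (- v +_) ys))
    loop-loses-v = begin
      positives (v ∷ ys)                     ≡⟨ positives-∷-pos ys 0<v ⟩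
      suc (positives ys)                     ≡⟨ cong suc (positives-shift-down ys 0<v outside) ⟨
      suc (positives (map (- v +_) ys))      ≡⟨ cong suc (positives-∷-nonpos (map (- v +_) ys) ℤP.≤-refl) ⟨
      suc (positives (0ℤ ∷ map (- v +_) ys)) ∎
      where open ≡-Reasoning
    count : OneFlawLess (A ++ r ∷ B ++ c ∷ C) (A ++ (c ∷ C) ++ r ∷ B)
    count = oneFlawLess-by-blocks (heights 0ℤ A) (v ∷ ys) hC (0ℤ ∷ map (- v +_) ys) hC heights-p heights-q
      (cong (ℕ._+ positives hC) loop-loses-v)
    raised : raise (A ++ (c ∷ C) ++ r ∷ B) ≡ A ++ r ∷ B ++ c ∷ C
    raised = raise-insertLoop≡ (A ++ (c ∷ C) ++ r ∷ B) last min below (firstVisit-complete A c C (A≢v , endA))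
      where
      last : lastVisit 0ℤ 0ℤ (A ++ (c ∷ C) ++ r ∷ B) ≡ just (A ++ c ∷ C , r , B)
      last = subst (λ q → lastVisit 0ℤ 0ℤ q ≡ just (A ++ c ∷ C , r , B)) (++-assoc A (c ∷ C) (r ∷ B))
        (lastVisit-complete (A ++ c ∷ C) r B (trans (endHeight-++ 0ℤ A _ endA) endC ,
          subst (All (_≢ 0ℤ)) (sym (heights-rebase (- v) B (0+δs≡-v+[v+δs] v r)))
            (AllP.map⁺ (All.map (outside-shift-down-≢0 0<v) outside))))
      min : minPositive (heights 0ℤ (A ++ c ∷ C)) ≡ just v
      min = minPositive-complete (subst (IsMinPositive v) (sym (heights-++ 0ℤ A _ endA))
        (0<v , ∈-++⁺ʳ (heights 0ℤ A) (here refl) , AllP.++⁺ least-A least-C))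
      below : All (λ x → x < 0ℤ → x ≤ - v) (heights 0ℤ (r ∷ B))
      below = subst (All _) (sym heights-loop)
        ((λ 0<0 → contradiction 0<0 (ℤP.<-irrefl refl)) ∷ AllP.map⁺ (All.map outside-shift-down-≤ outside))

  noRevisit-exchange : ∀ {v} A₀ b B r R → let p = A₀ ++ (b ∷ B) ++ r ∷ R; q = A₀ ++ (r ∷ R) ++ b ∷ B in
    endHeight 0ℤ p ≡ 0ℤ → IsMinPositive v (heights 0ℤ p) → FirstReach v 0ℤ (A₀ ++ b ∷ B) →
    All (_≢ v) (heights (v + δ r) R) → LastLeave 0ℤ 0ℤ A₀ b B → Exchange p q × raise q ≡ p
  noRevisit-exchange {v} A₀ b B r R closed (0<v , _ , least) (A≢v , endA) R≢v (endA₀ , B≢0) =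
    exchange (swap A₀ (b ∷ B) (r ∷ R)) count , raised
    where
    ys : List ℤ
    ys = heights (v + δ r) R
    hB : List ℤ
    hB = heights 0ℤ (b ∷ B)
    endB : endHeight 0ℤ (b ∷ B) ≡ v
    endB = trans (sym (endHeight-++ 0ℤ A₀ _ endA₀)) endA
    heights-p : heights 0ℤ (A₀ ++ (b ∷ B) ++ r ∷ R) ≡ heights 0ℤ A₀ ++ hB ++ (v ∷ ys)
    heights-p = trans (heights-++ 0ℤ A₀ _ endA₀)
      (cong (heights 0ℤ A₀ ++_) (heights-++ 0ℤ (b ∷ B) (r ∷ R) endB))
    endR : endHeight 0ℤ (r ∷ R) ≡ - v
    endR = begin
      endHeight 0ℤ (r ∷ R)        ≡⟨ endHeight-rebase (- v) R (0+δs≡-v+[v+δs] v r) ⟩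
      - v + endHeight v (r ∷ R)   ≡⟨ cong (- v +_) (endHeight-++ 0ℤ (b ∷ B) (r ∷ R) endB) ⟨
      - v + endHeight 0ℤ ((b ∷ B) ++ r ∷ R)
        ≡⟨ cong (- v +_) (trans (sym (endHeight-++ 0ℤ A₀ _ endA₀)) closed) ⟩
      - v + 0ℤ                    ≡⟨ ℤP.+-identityʳ (- v) ⟩
      - v                         ∎
      where open ≡-Reasoning
    heights-RB : heights 0ℤ (r ∷ R ++ b ∷ B) ≡ (0ℤ ∷ map (- v +_) ys) ++ map (- v +_) hB
    heights-RB = trans (heights-++ 0ℤ (r ∷ R) (b ∷ B) endR)
      (cong₂ _++_ (cong (0ℤ ∷_) (heights-rebase (- v) R (0+δs≡-v+[v+δs] v r)))
                  (heights-rebase (- v) (b ∷ B) (sym (ℤP.+-identityʳ (- v)))))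
    heights-q : heights 0ℤ (A₀ ++ (r ∷ R) ++ b ∷ B) ≡
                heights 0ℤ A₀ ++ (0ℤ ∷ map (- v +_) ys) ++ map (- v +_) hB
    heights-q = trans (heights-++ 0ℤ A₀ _ endA₀) (cong (heights 0ℤ A₀ ++_) heights-RB)
    least-p : All (λ x → 0ℤ < x → v ≤ x) (heights 0ℤ A₀ ++ hB ++ (v ∷ ys))
    least-p = subst (All _) heights-p least
    A≢v′ : All (_≢ v) (heights 0ℤ A₀ ++ hB)
    A≢v′ = subst (All _) (heights-++ 0ℤ A₀ _ endA₀) A≢v
    outside-A₀ : All (OutsideWindow v) (heights 0ℤ A₀)
    outside-A₀ = All.zipWith (λ (l , ≢v) → min⇒outside l ≢v)
      (AllP.++⁻ˡ (heights 0ℤ A₀) least-p , AllP.++⁻ˡ (heights 0ℤ A₀) A≢v′)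
    outside-B : All (OutsideWindow v) hB
    outside-B = All.zipWith (λ (l , ≢v) → min⇒outside l ≢v)
      (AllP.++⁻ˡ hB (AllP.++⁻ʳ (heights 0ℤ A₀) least-p) , AllP.++⁻ʳ (heights 0ℤ A₀) A≢v′)
    outside-ys : All (OutsideWindow v) ys
    outside-ys = All.zipWith (λ (l , ≢v) → min⇒outside l ≢v)
      (All.tail (AllP.++⁻ʳ hB (AllP.++⁻ʳ (heights 0ℤ A₀) least-p)) , R≢v)
    descent-loses-v : positives (v ∷ ys) ≡ suc (positives (0ℤ ∷ map (- v +_) ys))
    descent-loses-v = begin
      positives (v ∷ ys)                     ≡⟨ positives-∷-pos ys 0<v ⟩
      suc (positives ys)                     ≡⟨ cong suc (positives-shift-down ys 0<v outside-ys) ⟨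
      suc (positives (map (- v +_) ys))      ≡⟨ cong suc (positives-∷-nonpos (map (- v +_) ys) ℤP.≤-refl) ⟨
      suc (positives (0ℤ ∷ map (- v +_) ys)) ∎
      where open ≡-Reasoning
    count : OneFlawLess (A₀ ++ (b ∷ B) ++ r ∷ R) (A₀ ++ (r ∷ R) ++ b ∷ B)
    count = oneFlawLess-by-blocks (heights 0ℤ A₀) hB (v ∷ ys) (map (- v +_) hB) (0ℤ ∷ map (- v +_) ys)
      heights-p heights-q (begin
        positives hB ℕ.+ positives (v ∷ ys)
          ≡⟨ cong₂ ℕ._+_ (positives-shift-down hB 0<v outside-B) (sym descent-loses-v) ⟨
        positives (map (- v +_) hB) ℕ.+ suc (positives (0ℤ ∷ map (- v +_) ys))
          ≡⟨ NP.+-suc _ _ ⟩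
        suc (positives (map (- v +_) hB) ℕ.+ positives (0ℤ ∷ map (- v +_) ys)) ∎)
      where open ≡-Reasoning
    raised : raise (A₀ ++ (r ∷ R) ++ b ∷ B) ≡ A₀ ++ (b ∷ B) ++ r ∷ R
    raised = raise-moveBack≡ (A₀ ++ (r ∷ R) ++ b ∷ B) last maxNeg above
      (lastVisit-complete (r ∷ R) b B (endR , B≢-v))
      where
      below : All (λ x → x < 0ℤ → x ≤ - v) ((0ℤ ∷ map (- v +_) ys) ++ map (- v +_) hB)
      below = AllP.++⁺ ((λ 0<0 → contradiction 0<0 (ℤP.<-irrefl refl)) ∷
                        AllP.map⁺ (All.map outside-shift-down-≤ outside-ys))
                       (AllP.map⁺ (All.map outside-shift-down-≤ outside-B))
      last : lastVisit 0ℤ 0ℤ (A₀ ++ (r ∷ R) ++ b ∷ B) ≡ just (A₀ , r , R ++ b ∷ B)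
      last = lastVisit-complete A₀ r (R ++ b ∷ B) (endA₀ , subst (All (_≢ 0ℤ)) (sym (∷-injectiveʳ heights-RB))
        (AllP.++⁺ (AllP.map⁺ (All.map (outside-shift-down-≢0 0<v) outside-ys))
                  (AllP.map⁺ (All.map (outside-shift-down-≢0 0<v) outside-B))))
      maxNeg : maxNegative (heights 0ℤ (r ∷ R ++ b ∷ B)) ≡ just (- v)
      maxNeg = maxNegative-complete (subst (IsMaxNegative (- v)) (sym heights-RB)
        (ℤP.neg-mono-< 0<v , ∈-++⁺ʳ (0ℤ ∷ map (- v +_) ys) (here (sym (ℤP.+-identityʳ (- v)))) , below))
      above : All (λ x → 0ℤ < x → - - v < x) (heights 0ℤ A₀)
      above = All.map (λ o 0<x → subst (_< _) (sym (ℤP.neg-involutive v)) (outside⇒> o 0<x)) outside-A₀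
      B≢-v : All (_≢ - v) (heights (- v + δ b) B)
      B≢-v = subst (All (_≢ - v)) (sym (heights-rebase (- v) B (cong (- v +_) (sym (ℤP.+-identityˡ (δ b))))))
        (AllP.map⁺ (All.map (x≢0⇒d+x≢d (- v)) B≢0))

  moveBack-exchange : ∀ {w} U y Y₁ t T → let q = U ++ (y ∷ Y₁) ++ t ∷ T; p = U ++ (t ∷ T) ++ y ∷ Y₁ in
    w < 0ℤ → endHeight 0ℤ q ≡ 0ℤ → endHeight 0ℤ U ≡ 0ℤ →
    All (_≢ 0ℤ) (heights (0ℤ + δ y) (Y₁ ++ t ∷ T)) →
    All (λ x → x < 0ℤ → x ≤ w) (heights 0ℤ (y ∷ Y₁ ++ t ∷ T)) →
    All (λ x → 0ℤ < x → - w < x) (heights 0ℤ U) → LastLeave w 0ℤ (y ∷ Y₁) t T →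
    Exchange p q × lower p ≡ q
  moveBack-exchange {w} U y Y₁ t T w<0 closed endU Y≢0 below above (endY₁ , T≢w) =
    exchange (swap U (t ∷ T) (y ∷ Y₁)) count , lowered
    where
    V : ℤ
    V = - w
    0<V : 0ℤ < V
    0<V = ℤP.neg-mono-< w<0
    xs₁ : List ℤ
    xs₁ = heights (0ℤ + δ y) Y₁
    xs₂ : List ℤ
    xs₂ = heights (w + δ t) T
    endY₂ : endHeight w (t ∷ T) ≡ 0ℤ
    endY₂ = trans (sym (trans (endHeight-++ 0ℤ U _ endU) (endHeight-++ (0ℤ + δ y) Y₁ (t ∷ T) endY₁))) closed
    heights-Y : heights (0ℤ + δ y) (Y₁ ++ t ∷ T) ≡ xs₁ ++ (w ∷ xs₂)
    heights-Y = heights-++ (0ℤ + δ y) Y₁ (t ∷ T) endY₁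
    heights-q : heights 0ℤ (U ++ (y ∷ Y₁) ++ t ∷ T) ≡ heights 0ℤ U ++ (0ℤ ∷ xs₁) ++ (w ∷ xs₂)
    heights-q = trans (heights-++ 0ℤ U _ endU) (cong (λ hs → heights 0ℤ U ++ 0ℤ ∷ hs) heights-Y)
    endY₂′ : endHeight 0ℤ (t ∷ T) ≡ V
    endY₂′ = trans (endHeight-rebase V T (0+δs≡-v+[v+δs] w t)) (trans (cong (V +_) endY₂) (ℤP.+-identityʳ V))
    heights-Y₂ : heights 0ℤ (t ∷ T) ≡ 0ℤ ∷ map (V +_) xs₂
    heights-Y₂ = cong (0ℤ ∷_) (heights-rebase V T (0+δs≡-v+[v+δs] w t))
    heights-Y₁ : heights V (y ∷ Y₁) ≡ V ∷ map (V +_) xs₁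
    heights-Y₁ = cong (V ∷_) (heights-rebase V Y₁ (cong (V +_) (sym (ℤP.+-identityˡ (δ y)))))
    heights-p : heights 0ℤ (U ++ (t ∷ T) ++ y ∷ Y₁) ≡
                heights 0ℤ U ++ (0ℤ ∷ map (V +_) xs₂) ++ (V ∷ map (V +_) xs₁)
    heights-p = trans (heights-++ 0ℤ U _ endU) (cong (heights 0ℤ U ++_)
      (trans (heights-++ 0ℤ (t ∷ T) (y ∷ Y₁) endY₂′) (cong₂ _++_ heights-Y₂ heights-Y₁)))
    below-Y : All (λ x → x < 0ℤ → x ≤ - V) (xs₁ ++ (w ∷ xs₂))
    below-Y = subst (All _) heights-Y
      (All.map (λ x≤w x<0 → subst (_ ≤_) (sym (ℤP.neg-involutive w)) (x≤w x<0)) (All.tail below))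
    Y≢0′ : All (_≢ 0ℤ) (xs₁ ++ (w ∷ xs₂))
    Y≢0′ = subst (All _) heights-Y Y≢0
    outside₁ : All (λ x → OutsideWindow V (V + x)) xs₁
    outside₁ = All.zipWith (λ (b , ≢0) → outside-shift-up b ≢0)
      (AllP.++⁻ˡ xs₁ below-Y , AllP.++⁻ˡ xs₁ Y≢0′)
    outside₂ : All (λ x → OutsideWindow V (V + x)) xs₂
    outside₂ = All.zipWith (λ (b , ≢0) → outside-shift-up b ≢0)
      (All.tail (AllP.++⁻ʳ xs₁ below-Y) , All.tail (AllP.++⁻ʳ xs₁ Y≢0′))
    outside-U : All (OutsideWindow V) (heights 0ℤ U)
    outside-U = All.map >⇒outside above
    descent-keeps-signs : positives (0ℤ ∷ map (V +_) xs₂) ≡ positives (w ∷ xs₂)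
    descent-keeps-signs = begin
      positives (0ℤ ∷ map (V +_) xs₂) ≡⟨ positives-∷-nonpos (map (V +_) xs₂) ℤP.≤-refl ⟩
      positives (map (V +_) xs₂)      ≡⟨ positives-shift-up xs₂ 0<V outside₂ ⟩
      positives xs₂                   ≡⟨ positives-∷-nonpos xs₂ (ℤP.<⇒≤ w<0) ⟨
      positives (w ∷ xs₂)             ∎
      where open ≡-Reasoning
    ascent-gains-V : positives (V ∷ map (V +_) xs₁) ≡ suc (positives (0ℤ ∷ xs₁))
    ascent-gains-V = begin
      positives (V ∷ map (V +_) xs₁)   ≡⟨ positives-∷-pos (map (V +_) xs₁) 0<V ⟩
      suc (positives (map (V +_) xs₁)) ≡⟨ cong suc (positives-shift-up xs₁ 0<V outside₁) ⟩
      suc (positives xs₁)              ≡⟨ cong suc (positives-∷-nonpos xs₁ ℤP.≤-refl) ⟨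
      suc (positives (0ℤ ∷ xs₁))       ∎
      where open ≡-Reasoning
    count : OneFlawLess (U ++ (t ∷ T) ++ y ∷ Y₁) (U ++ (y ∷ Y₁) ++ t ∷ T)
    count = oneFlawLess-by-blocks (heights 0ℤ U) (0ℤ ∷ map (V +_) xs₂) (V ∷ map (V +_) xs₁)
      (w ∷ xs₂) (0ℤ ∷ xs₁) heights-p heights-q
      (trans (cong₂ ℕ._+_ descent-keeps-signs ascent-gains-V) (NP.+-suc _ _))
    lowered : lower (U ++ (t ∷ T) ++ y ∷ Y₁) ≡ U ++ (y ∷ Y₁) ++ t ∷ T
    lowered = lower-noRevisit≡ (U ++ (t ∷ T) ++ y ∷ Y₁) min first revisit last
      where
      least-shifted : ∀ {xs} → All (λ x → OutsideWindow V (V + x)) xs →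
        All (λ x → 0ℤ < x → V ≤ x) (map (V +_) xs)
      least-shifted = AllP.map⁺ ∘ All.map (λ o 0<x → ℤP.<⇒≤ (outside⇒> o 0<x))
      least-p : All (λ x → 0ℤ < x → V ≤ x)
        (heights 0ℤ U ++ (0ℤ ∷ map (V +_) xs₂) ++ (V ∷ map (V +_) xs₁))
      least-p = AllP.++⁺ (All.map (λ above 0<x → ℤP.<⇒≤ (above 0<x)) above)
        (AllP.++⁺ ((λ 0<0 → contradiction 0<0 (ℤP.<-irrefl refl)) ∷ least-shifted outside₂)
                  ((λ _ → ℤP.≤-refl) ∷ least-shifted outside₁))
      min : minPositive (heights 0ℤ (U ++ (t ∷ T) ++ y ∷ Y₁)) ≡ just V
      min = minPositive-complete (subst (IsMinPositive V) (sym heights-p)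
        (0<V , ∈-++⁺ʳ (heights 0ℤ U) (∈-++⁺ʳ (0ℤ ∷ map (V +_) xs₂) (here refl)) , least-p))
      first : firstVisit V 0ℤ (U ++ (t ∷ T) ++ y ∷ Y₁) ≡ just (U ++ t ∷ T , y , Y₁)
      first = subst (λ p → firstVisit V 0ℤ p ≡ just (U ++ t ∷ T , y , Y₁)) (++-assoc U (t ∷ T) (y ∷ Y₁))
        (firstVisit-complete (U ++ t ∷ T) y Y₁
          (subst (All (_≢ V)) (sym (trans (heights-++ 0ℤ U (t ∷ T) endU) (cong (heights 0ℤ U ++_) heights-Y₂)))
            (AllP.++⁺ (All.map (outside⇒≢ 0<V) outside-U)
                      ((λ 0≡V → ℤP.<-irrefl 0≡V 0<V) ∷ AllP.map⁺ (All.map (outside⇒≢ 0<V) outside₂))) ,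
           trans (endHeight-++ 0ℤ U (t ∷ T) endU) endY₂′))
      revisit : firstVisit V (V + δ y) Y₁ ≡ nothing
      revisit = firstVisit-avoid Y₁ (subst (All (_≢ V))
        (sym (heights-rebase V Y₁ (cong (V +_) (sym (ℤP.+-identityˡ (δ y))))))
        (AllP.map⁺ (All.map (outside⇒≢ 0<V) outside₁)))
      last : lastVisit 0ℤ 0ℤ (U ++ t ∷ T) ≡ just (U , t , T)
      last = lastVisit-complete U t T (endU , subst (All (_≢ 0ℤ)) (sym (heights-rebase V T (0+δs≡-v+[v+δs] w t)))
        (AllP.map⁺ (All.map x≢w⇒-w+x≢0 T≢w)))

  insertLoop-exchange : ∀ {v} X z Z y Y → let q = X ++ (z ∷ Z) ++ y ∷ Y; p = X ++ (y ∷ Y) ++ z ∷ Z in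
    endHeight 0ℤ q ≡ 0ℤ → endHeight 0ℤ (X ++ z ∷ Z) ≡ 0ℤ → All (_≢ 0ℤ) (heights (0ℤ + δ y) Y) →
    IsMinPositive v (heights 0ℤ (X ++ z ∷ Z)) → FirstReach v 0ℤ X →
    All (λ x → x < 0ℤ → x ≤ - v) (heights 0ℤ (y ∷ Y)) → Exchange p q × lower p ≡ q
  insertLoop-exchange {v} X z Z y Y closed endU Y≢0 (0<v , _ , least) (X≢v , endX) below =
    exchange (swap X (y ∷ Y) (z ∷ Z)) count , lowered
    where
    xs : List ℤ
    xs = heights (0ℤ + δ y) Y
    hZ : List ℤ
    hZ = heights v (z ∷ Z)
    endZ : endHeight v (z ∷ Z) ≡ 0ℤ
    endZ = trans (sym (endHeight-++ 0ℤ X (z ∷ Z) endX)) endU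
    endY : endHeight 0ℤ (y ∷ Y) ≡ 0ℤ
    endY = trans (sym (endHeight-++ 0ℤ (X ++ z ∷ Z) (y ∷ Y) endU))
      (trans (cong (endHeight 0ℤ) (++-assoc X (z ∷ Z) (y ∷ Y))) closed)
    heights-q : heights 0ℤ (X ++ (z ∷ Z) ++ y ∷ Y) ≡ heights 0ℤ X ++ hZ ++ (0ℤ ∷ xs)
    heights-q = trans (heights-++ 0ℤ X _ endX) (cong (heights 0ℤ X ++_) (heights-++ v (z ∷ Z) (y ∷ Y) endZ))
    rebase-y : v + δ y ≡ v + (0ℤ + δ y)
    rebase-y = cong (v +_) (sym (ℤP.+-identityˡ (δ y)))
    endY′ : endHeight v (y ∷ Y) ≡ v
    endY′ = trans (endHeight-rebase v Y rebase-y) (trans (cong (v +_) endY) (ℤP.+-identityʳ v))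
    heights-p : heights 0ℤ (X ++ (y ∷ Y) ++ z ∷ Z) ≡ heights 0ℤ X ++ (v ∷ map (v +_) xs) ++ hZ
    heights-p = trans (heights-++ 0ℤ X _ endX) (cong (heights 0ℤ X ++_)
      (trans (heights-++ v (y ∷ Y) (z ∷ Z) endY′) (cong (λ hs → v ∷ hs ++ hZ) (heights-rebase v Y rebase-y))))
    outside : All (λ x → OutsideWindow v (v + x)) xs
    outside = All.zipWith (λ (b , ≢0) → outside-shift-up b ≢0) (All.tail below , Y≢0)
    loop-gains-v : positives (v ∷ map (v +_) xs) ≡ suc (positives (0ℤ ∷ xs))
    loop-gains-v = begin
      positives (v ∷ map (v +_) xs)   ≡⟨ positives-∷-pos (map (v +_) xs) 0<v ⟩
      suc (positives (map (v +_) xs)) ≡⟨ cong suc (positives-shift-up xs 0<v outside) ⟩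
      suc (positives xs)              ≡⟨ cong suc (positives-∷-nonpos xs ℤP.≤-refl) ⟨
      suc (positives (0ℤ ∷ xs))       ∎
      where open ≡-Reasoning
    count : OneFlawLess (X ++ (y ∷ Y) ++ z ∷ Z) (X ++ (z ∷ Z) ++ y ∷ Y)
    count = oneFlawLess-by-blocks (heights 0ℤ X) (v ∷ map (v +_) xs) hZ (0ℤ ∷ xs) hZ heights-p heights-q
      (cong (ℕ._+ positives hZ) loop-gains-v)
    lowered : lower (X ++ (y ∷ Y) ++ z ∷ Z) ≡ X ++ (z ∷ Z) ++ y ∷ Y
    lowered = lower-revisit≡ (X ++ (y ∷ Y) ++ z ∷ Z) min (firstVisit-complete X y (Y ++ z ∷ Z) (X≢v , endX))
      (firstVisit-complete Y z Z (subst (All (_≢ v)) (sym (heights-rebase v Y rebase-y))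
        (AllP.map⁺ (All.map (outside⇒≢ 0<v) outside)) , endY′))
      where
      least-U : All (λ x → 0ℤ < x → v ≤ x) (heights 0ℤ X ++ hZ)
      least-U = subst (All _) (heights-++ 0ℤ X (z ∷ Z) endX) least
      min : minPositive (heights 0ℤ (X ++ (y ∷ Y) ++ z ∷ Z)) ≡ just v
      min = minPositive-complete (subst (IsMinPositive v) (sym heights-p)
        (0<v , ∈-++⁺ʳ (heights 0ℤ X) (here refl) ,
         AllP.++⁺ (AllP.++⁻ˡ (heights 0ℤ X) least-U)
           (AllP.++⁺ ((λ _ → ℤP.≤-refl) ∷ AllP.map⁺ (All.map (λ o → ℤP.<⇒≤ ∘′ outside⇒> o) outside))
                     (AllP.++⁻ʳ (heights 0ℤ X) least-U))))

  lower-spec : ∀ p → endHeight 0ℤ p ≡ 0ℤ → 0 ℕ.< positives (heights 0ℤ p) →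
    Exchange p (lower p) × raise (lower p) ≡ p
  lower-spec p closed flawed with minPositive (heights 0ℤ p) in m
  ... | nothing = contradiction (positives-none (minPositive-nothing {heights 0ℤ p} m)) (NP.>⇒≢ flawed)
  ... | just v with minPositive-just m | firstVisit v 0ℤ p in f₁
  ...   | _ , v∈ , _ | nothing = contradiction refl (All.lookup (firstVisit-nothing p f₁) v∈)
  ...   | min | just (A , r , R) with firstVisit-just p f₁ | firstVisit v (v + δ r) R in f₂
  ...     | refl , reachA | just (B , c , C) with refl , reachB ← firstVisit-just R f₂ =
    revisit-exchange A r B c C closed min reachA reachB
  ...     | refl , reachA | nothing with lastVisit 0ℤ 0ℤ A in l
  ...       | nothing = contradiction (lastVisit-nothing A l) (no-zero-before A (proj₂ reachA))
    where
    no-zero-before : ∀ A → endHeight 0ℤ A ≡ v → ¬ All (_≢ 0ℤ) (heights 0ℤ A)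
    no-zero-before []      0≡v _         = ℤP.<-irrefl 0≡v (proj₁ min)
    no-zero-before (_ ∷ _) _   (0≢0 ∷ _) = 0≢0 refl
  ...       | just (A₀ , b , B) with refl , leave ← lastVisit-just A l =
    subst (λ p′ → Exchange p′ q × raise q ≡ p′) (sym assoc)
      (noRevisit-exchange A₀ b B r R (subst (λ p′ → endHeight 0ℤ p′ ≡ 0ℤ) assoc closed)
        (subst (λ p′ → IsMinPositive v (heights 0ℤ p′)) assoc min) reachA (firstVisit-nothing R f₂) leave)
    where
    q : List Step
    q = A₀ ++ (r ∷ R) ++ b ∷ B
    assoc : (A₀ ++ b ∷ B) ++ r ∷ R ≡ A₀ ++ (b ∷ B) ++ r ∷ R
    assoc = ++-assoc A₀ (b ∷ B) (r ∷ R)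

  insertLoop-spec : ∀ U y Y {v} → endHeight 0ℤ (U ++ y ∷ Y) ≡ 0ℤ → endHeight 0ℤ U ≡ 0ℤ →
    All (_≢ 0ℤ) (heights (0ℤ + δ y) Y) → minPositive (heights 0ℤ U) ≡ just v →
    All (λ x → x < 0ℤ → x ≤ - v) (heights 0ℤ (y ∷ Y)) →
    Exchange (insertLoop v U (y ∷ Y)) (U ++ y ∷ Y) × lower (insertLoop v U (y ∷ Y)) ≡ U ++ y ∷ Y
  insertLoop-spec U y Y {v} closed endU Y≢0 m below with minPositive-just m | firstVisit v 0ℤ U in f
  ... | _ , v∈ , _ | nothing = contradiction refl (All.lookup (firstVisit-nothing U f) v∈)
  ... | min | just (X , z , Z) with refl , reachX ← firstVisit-just U f =
    subst (λ q → Exchange p q × lower p ≡ q) (sym assoc)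
      (insertLoop-exchange X z Z y Y (subst (λ q → endHeight 0ℤ q ≡ 0ℤ) assoc closed) endU Y≢0 min reachX below)
    where
    p : List Step
    p = X ++ (y ∷ Y) ++ z ∷ Z
    assoc : (X ++ z ∷ Z) ++ y ∷ Y ≡ X ++ (z ∷ Z) ++ y ∷ Y
    assoc = ++-assoc X (z ∷ Z) (y ∷ Y)

  moveBack-spec : ∀ U y Y {w} → endHeight 0ℤ (U ++ y ∷ Y) ≡ 0ℤ → endHeight 0ℤ U ≡ 0ℤ →
    All (_≢ 0ℤ) (heights (0ℤ + δ y) Y) → maxNegative (heights 0ℤ (y ∷ Y)) ≡ just w →
    All (λ x → 0ℤ < x → - w < x) (heights 0ℤ U) →
    Exchange (moveBack w U (y ∷ Y)) (U ++ y ∷ Y) × lower (moveBack w U (y ∷ Y)) ≡ U ++ y ∷ Y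
  moveBack-spec U y Y {w} closed endU Y≢0 n above with maxNegative-just n | lastVisit w 0ℤ (y ∷ Y) in l
  ... | _ , w∈ , _ | nothing = contradiction refl (All.lookup (lastVisit-nothing (y ∷ Y) l) w∈)
  ... | w<0 , _ , below | just (Y₁′ , t , T) with lastVisit-just (y ∷ Y) l
  ...   | eq , endY₁ , T≢w with Y₁′
  ...     | [] = contradiction (sym endY₁) (ℤP.<⇒≢ w<0)
  ...     | _ ∷ Y₁ with refl ← eq =
    moveBack-exchange U y Y₁ t T w<0 closed endU Y≢0 below above (endY₁ , T≢w)

  raise-spec : ∀ q → q ≢ [] → endHeight 0ℤ q ≡ 0ℤ → ¬ Split q →
    Exchange (raise q) q × lower (raise q) ≡ q
  raise-spec q q≢[] closed ¬split with lastVisit 0ℤ 0ℤ q in l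
  ... | nothing = contradiction (lastVisit-nothing q l) (starts-at-0 q q≢[])
    where
    starts-at-0 : ∀ q → q ≢ [] → ¬ All (_≢ 0ℤ) (heights 0ℤ q)
    starts-at-0 []      []≢[] _         = []≢[] refl
    starts-at-0 (_ ∷ _) _     (0≢0 ∷ _) = 0≢0 refl
  ... | just (U , y , Y) with lastVisit-just q l
  ... | refl , endU , Y≢0 with minPositive (heights 0ℤ U) in m | maxNegative (heights 0ℤ (y ∷ Y)) in n
  ... | nothing | nothing = contradiction (split U y Y endU nonpos pos) ¬split
    where
    nonpos : All (_≤ 0ℤ) (heights 0ℤ U)
    nonpos = All.map ℤP.≮⇒≥ (minPositive-nothing m)
    pos : All (0ℤ <_) (heights (0ℤ + δ y) Y)
    pos = All.zipWith (λ (x≮0 , x≢0) → ℤP.≤∧≢⇒< (ℤP.≮⇒≥ x≮0) (x≢0 ∘′ sym))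
      (All.tail (maxNegative-nothing {heights 0ℤ (y ∷ Y)} n) , Y≢0)
  ... | just v  | nothing = insertLoop-spec U y Y closed endU Y≢0 m
    (All.map (λ x≮0 x<0 → contradiction x<0 x≮0) (maxNegative-nothing {heights 0ℤ (y ∷ Y)} n))
  ... | nothing | just w  = moveBack-spec U y Y closed endU Y≢0 n
    (All.map (λ 0≮x 0<x → contradiction 0<x 0≮x) (minPositive-nothing m))
  ... | just v  | just w with 0ℤ ℤP.<? w + v | minPositive-just m | maxNegative-just n
  ...   | yes 0<w+v | _ , _ , least | _ = moveBack-spec U y Y closed endU Y≢0 n
    (All.map (λ v≤x 0<x → ℤP.<-≤-trans (0<w+v⇒-w<v 0<w+v) (v≤x 0<x)) least)
  ...   | no 0≮w+v  | _ | _ , _ , below = insertLoop-spec U y Y closed endU Y≢0 m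
    (All.map (λ x≤w x<0 → ℤP.≤-trans (x≤w x<0) (w+v≤0⇒w≤-v (ℤP.≮⇒≥ 0≮w+v))) below)

module Bridge (a b : ℕ) where

  open import Data.Integer using (-_; _+_; _≤_; _<_)
  open Heights a b
  open LowerRaise a b

  height : ℕ × ℕ → ℤ
  height (x , y) = - ℤ.+ (x * b) + ℤ.+ (y * a)

  height-move : ∀ q s → height (move q s) ≡ height q + δ s
  height-move (x , y) E = trans (cong (λ n → - n + ℤ.+ (y * a)) (ℤP.pos-+ b (x * b)))
    (solve 3 (λ B X Y → :- (B :+ X) :+ Y := (:- X :+ Y) :+ :- B) refl (ℤ.+ b) (ℤ.+ (x * b)) (ℤ.+ (y * a)))
    where open +-*-Solver
  height-move (x , y) N = trans (cong (λ n → - ℤ.+ (x * b) + n) (ℤP.pos-+ a (y * a)))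
    (solve 3 (λ A X Y → :- X :+ (A :+ Y) := (:- X :+ Y) :+ A) refl (ℤ.+ a) (ℤ.+ (x * b)) (ℤ.+ (y * a)))
    where open +-*-Solver

  heights-pointsFrom : ∀ q p → map height (pointsFrom q p) ≡ heights (height q) p ∷ʳ endHeight (height q) p
  heights-pointsFrom q []       = refl
  heights-pointsFrom q (s ∷ ss) = cong (height q ∷_) (trans (heights-pointsFrom (move q s) ss)
    (cong (λ h → heights h ss ∷ʳ endHeight h ss) (height-move q s)))

  endHeight-endpt : ∀ h p → endHeight h p ≡ h + height (endpt p)
  endHeight-endpt h []      = sym (ℤP.+-identityʳ h)
  endHeight-endpt h (s ∷ ss) = trans (endHeight-endpt (h + δ s) ss) (trans (ℤP.+-assoc h (δ s) _)
    (cong (h +_) (trans (ℤP.+-comm (δ s) _) (sym (step s)))))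
    where
    step : ∀ s → height (endpt (s ∷ ss)) ≡ height (endpt ss) + δ s
    step E = height-move (endpt ss) E
    step N = height-move (endpt ss) N

  height-diagonal : ∀ g → height (g * a , g * b) ≡ 0ℤ
  height-diagonal g = trans (cong (λ n → - ℤ.+ n + ℤ.+ (g * b * a)) gab≡gba) (ℤP.+-inverseˡ (ℤ.+ (g * b * a)))
    where
    gab≡gba : g * a * b ≡ g * b * a
    gab≡gba = ℕ-Solver.solve 3 (λ g a b → g :* a :* b := g :* b :* a) refl g a b
      where open ℕ-Solver using (_:*_; _:=_)

  endpt⇒closed : ∀ g p → endpt p ≡ (g * a , g * b) → endHeight 0ℤ p ≡ 0ℤ
  endpt⇒closed g p e =
    trans (endHeight-endpt 0ℤ p) (trans (ℤP.+-identityˡ _) (trans (cong height e) (height-diagonal g)))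

  strictlyAbove⇔0<height : ∀ g {q} → 0 ℕ.< g → T (strictlyAbove (g * a , g * b) q) ⇔ 0ℤ < height q
  strictlyAbove⇔0<height (suc g) {x , y} _ = mk⇔
    (λ above → v<y⇒0<-v+y (ℤ.+<+ (NP.*-cancelˡ-< (suc g) (x * b) (y * a)
                 (subst₂ ℕ._<_ (reassoc x) (reassoc y) (NP.<ᵇ⇒< _ _ above)))))
    (λ 0<h → NP.<⇒<ᵇ (subst₂ ℕ._<_ (sym (reassoc x)) (sym (reassoc y))
                 (NP.*-monoʳ-< (suc g) (ℤP.drop‿+<+ (0<-v+y⇒v<y 0<h)))))
    where
    reassoc : ∀ u {c} → u * (suc g * c) ≡ suc g * (u * c)
    reassoc u {c} = ℕ-Solver.solve 3 (λ u g c → u :* (g :* c) := g :* (u :* c)) refl u (suc g) c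
      where open ℕ-Solver using (_:*_; _:=_)

  flaws≡positives : ∀ g p → 0 ℕ.< g → endpt p ≡ (g * a , g * b) → flaws p ≡ positives (heights 0ℤ p)
  flaws≡positives g p 0<g e = begin
    flaws p
      ≡⟨ cong (λ q → length (filterᵇ (strictlyAbove q) (pointsFrom (0 , 0) p))) e ⟩
    length (filter (T? ∘ strictlyAbove (g * a , g * b)) (pointsFrom (0 , 0) p))
      ≡⟨ sym (length-filter-map (T? ∘ strictlyAbove (g * a , g * b)) (0ℤ ℤP.<?_) {f = height}
               (All.universal (λ q → ⇔-sym (strictlyAbove⇔0<height g {q} 0<g)) (pointsFrom (0 , 0) p))) ⟩
    positives (map height (pointsFrom (0 , 0) p))
      ≡⟨ cong positives (heights-pointsFrom (0 , 0) p) ⟩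
    positives (heights 0ℤ p ∷ʳ endHeight 0ℤ p)
      ≡⟨ positives-++ (heights 0ℤ p) _ ⟩
    positives (heights 0ℤ p) ℕ.+ positives (endHeight 0ℤ p ∷ [])
      ≡⟨ cong (λ h → positives (heights 0ℤ p) ℕ.+ positives (h ∷ [])) (endpt⇒closed g p e) ⟩
    positives (heights 0ℤ p) ℕ.+ 0
      ≡⟨ NP.+-identityʳ _ ⟩
    positives (heights 0ℤ p) ∎
    where open ≡-Reasoning

  T-inN : ∀ g p → T (inN a b g p) ⇔ endpt p ≡ (g * a , g * b)
  T-inN g p = mk⇔
    (λ t → let t₁ , t₂ = to T-∧ t in ×-≡,≡→≡ (NP.≡ᵇ⇒≡ _ _ t₁ , NP.≡ᵇ⇒≡ _ _ t₂))
    (λ e → from T-∧ (NP.≡⇒≡ᵇ _ _ (cong proj₁ e) , NP.≡⇒≡ᵇ _ _ (cong proj₂ e)))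

  T-inNk : ∀ g k p → T (inNk a b g k p) ⇔ (endpt p ≡ (g * a , g * b) × flaws p ≡ k)
  T-inNk g k p = mk⇔
    (λ t → let t₁ , t₂ = to T-∧ t in to (T-inN g p) t₁ , NP.≡ᵇ⇒≡ _ _ t₂)
    (λ (e , f) → from T-∧ (from (T-inN g p) e , NP.≡⇒≡ᵇ _ _ f))

  record SDecomposition (g k : ℕ) (q : List Step) : Set where
    field
      j          : ℕ
      U Y        : List Step
      0<j        : 0 ℕ.< j
      j<g        : j ℕ.< g
      max-flaws  : suc k ≡ j * (a ℕ.+ b)
      split-q    : q ≡ U ++ Y
      U-endpt    : endpt U ≡ ((g ∸ j) * a , (g ∸ j) * b)
      U-flawless : flaws U ≡ 0
      Y-endpt    : endpt Y ≡ (j * a , j * b)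
      Y-flaws    : flaws Y ≡ k

  inS⇒SDecomposition : ∀ g k q → T (inS a b g k q) → SDecomposition g k q
  inS⇒SDecomposition g k q t with find (any⁻ _ (upTo g) (proj₂ (to (T-∧ {inNk a b g k q}) t)))
  ... | zero  , _  , ()
  ... | suc j , j∈ , t-j
    with t-k , t-i ← to (T-∧ {suc k ≡ᵇ suc j * (a ℕ.+ b)}) t-j
    with i , _ , t-UY ← find (any⁻ _ (upTo (suc (length q))) t-i)
    with t-U , t-Y ← to (T-∧ {inNk a b (g ∸ suc j) 0 (take i q)}) t-UY
    with U-endpt , U-flawless ← to (T-inNk (g ∸ suc j) 0 (take i q)) t-U
    with Y-endpt , Y-flaws ← to (T-inNk (suc j) k (drop i q)) t-Y =
    record { j = suc j ; U = take i q ; Y = drop i q ; 0<j = ℕ.z<s ; j<g = ∈-upTo⁻ j∈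
           ; max-flaws = NP.≡ᵇ⇒≡ _ _ t-k ; split-q = sym (take++drop≡id i q)
           ; U-endpt = U-endpt ; U-flawless = U-flawless ; Y-endpt = Y-endpt ; Y-flaws = Y-flaws }

  SDecomposition⇒inS : ∀ g k q → T (inNk a b g k q) → SDecomposition g k q → T (inS a b g k q)
  SDecomposition⇒inS g k q t-q d =
    from T-∧ (t-q , any⁺ _ (lose (∈-upTo⁺ j<g) (from T-∧ (nonzero 0<j ,
      from T-∧ (NP.≡⇒≡ᵇ _ _ max-flaws ,
        any⁺ _ (lose (∈-upTo⁺ (ℕ.s≤s U≤q)) (from T-∧ (t-U , t-Y))))))))
    where
    open SDecomposition d
    nonzero : ∀ {j} → 0 ℕ.< j → T (not (j ≡ᵇ 0))
    nonzero ℕ.z<s = _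
    U≤q : length U ℕ.≤ length q
    U≤q = subst (length U ℕ.≤_) (sym (trans (cong length split-q) (length-++ U))) (NP.m≤m+n (length U) (length Y))
    t-U : T (inNk a b (g ∸ j) 0 (take (length U) q))
    t-U = subst (T ∘ inNk a b (g ∸ j) 0) (sym (trans (cong (take (length U)) split-q) (take-length-++ U Y)))
            (from (T-inNk (g ∸ j) 0 U) (U-endpt , U-flawless))
    t-Y : T (inNk a b j k (drop (length U) q))
    t-Y = subst (T ∘ inNk a b j k) (sym (trans (cong (drop (length U)) split-q) (drop-length-++ U Y)))
            (from (T-inNk j k Y) (Y-endpt , Y-flaws))

  length-diagonal : ∀ g p → endpt p ≡ (g * a , g * b) → length p ≡ g * (a ℕ.+ b)
  length-diagonal g p e =
    trans (length≡x+y p) (trans (cong (λ q → proj₁ q ℕ.+ proj₂ q) e) (sym (NP.*-distribˡ-+ g a b)))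

  endpt-suffix : ∀ g t U Y → endpt (U ++ Y) ≡ (g * a , g * b) → endpt U ≡ (t * a , t * b) →
    endpt Y ≡ ((g ∸ t) * a , (g ∸ t) * b)
  endpt-suffix g t U Y eUY eU = ×-≡,≡→≡ (solve-for a (cong proj₁ sums) , solve-for b (cong proj₂ sums))
    where
    sums : (t * a ℕ.+ proj₁ (endpt Y) , t * b ℕ.+ proj₂ (endpt Y)) ≡ (g * a , g * b)
    sums = trans (sym (cong (λ q → proj₁ q ℕ.+ proj₁ (endpt Y) , proj₂ q ℕ.+ proj₂ (endpt Y)) eU))
             (trans (sym (endpt-++ U Y)) eUY)
    solve-for : ∀ c {x} → t * c ℕ.+ x ≡ g * c → x ≡ (g ∸ t) * c
    solve-for c {x} e =
      trans (sym (NP.m+n∸m≡n (t * c) x)) (trans (cong (_∸ t * c) e) (sym (NP.*-distribʳ-∸ c g t)))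

  height≡0⇒ya≡xb : ∀ x y → height (x , y) ≡ 0ℤ → y * a ≡ x * b
  height≡0⇒ya≡xb x y h≡0 = ℤP.+-injective (trans (sym (v+[-v+x]≡x (ℤ.+ (x * b)) (ℤ.+ (y * a))))
    (trans (cong (ℤ.+ (x * b) +_) h≡0) (ℤP.+-identityʳ _)))

  height≡0⇒diagonal : Coprime a b → 0 ℕ.< a → ∀ q → height q ≡ 0ℤ → ∃ λ t → q ≡ (t * a , t * b)
  height≡0⇒diagonal cop 0<a (x , y) h≡0
    with divides t refl ← coprime-divisor cop (divides y (trans (NP.*-comm b x) (sym (height≡0⇒ya≡xb x y h≡0)))) =
    t , cong (t * a ,_) (NP.*-cancelʳ-≡ y (t * b) a {{ℕ.>-nonZero 0<a}} (trans (height≡0⇒ya≡xb (t * a) y h≡0)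
        (ℕ-Solver.solve 3 (λ t a b → t :* a :* b := t :* b :* a) refl t a b)))
    where open ℕ-Solver using (_:*_; _:=_)

  SDecomposition⇒Split : ∀ {g k q} → SDecomposition g k q → Split q
  SDecomposition⇒Split {g} {k} d = subst Split (sym split-q)
    (build Y Y-endpt Y-flaws (trans max-flaws (sym (length-diagonal j Y Y-endpt))))
    where
    open SDecomposition d
    build : ∀ Y → endpt Y ≡ (j * a , j * b) → flaws Y ≡ k → suc k ≡ length Y → Split (U ++ Y)
    build (s ∷ ss) e f l = split U s ss (endpt⇒closed (g ∸ j) U U-endpt)
      (positives≡0⇒nonpos _ (trans (sym (flaws≡positives (g ∸ j) U (NP.m<n⇒0<n∸m j<g) U-endpt)) U-flawless))
      (positives≡length⇒pos _ (begin
        positives (heights (0ℤ + δ s) ss)   ≡⟨ sym (positives-∷-nonpos (heights (0ℤ + δ s) ss) ℤP.≤-refl) ⟩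
        positives (heights 0ℤ (s ∷ ss))     ≡⟨ sym (flaws≡positives j (s ∷ ss) 0<j e) ⟩
        flaws (s ∷ ss)                      ≡⟨ trans f (NP.suc-injective l) ⟩
        length ss                           ≡⟨ sym (length-heights (0ℤ + δ s) ss) ⟩
        length (heights (0ℤ + δ s) ss)      ∎))
      where open ≡-Reasoning

  Split⇒SDecomposition : Coprime a b → 0 ℕ.< a → ∀ g k q → endpt q ≡ (g * a , g * b) → flaws q ≡ k →
    suc k ℕ.< g * (a ℕ.+ b) → Split q → SDecomposition g k q
  Split⇒SDecomposition cop 0<a g k q e f big (split U s ss endU nonpos pos)
    with t , U-endpt ← height≡0⇒diagonal cop 0<a (endpt U)
           (trans (sym (ℤP.+-identityˡ _)) (trans (sym (endHeight-endpt 0ℤ U)) endU)) =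
    record { j = g ∸ t ; U = U ; Y = s ∷ ss ; 0<j = 0<j ; j<g = NP.∸-monoʳ-< {g} {t} {0} 0<t (NP.<⇒≤ t<g)
           ; max-flaws = max-flaws ; split-q = refl
           ; U-endpt = subst (λ i → endpt U ≡ (i * a , i * b)) (sym (NP.m∸[m∸n]≡n (NP.<⇒≤ t<g))) U-endpt
           ; U-flawless = trans (flaws≡positives t U 0<t U-endpt) (positives-none (All.map ℤP.≤⇒≯ nonpos))
           ; Y-endpt = Y-endpt
           ; Y-flaws = trans (flaws≡positives (g ∸ t) (s ∷ ss) 0<j Y-endpt) (trans positives-Y (sym k≡)) }
    where
    0<g : 0 ℕ.< g
    0<g = NP.n≢0⇒n>0 λ { refl → NP.n≮0 big }
    positives-Y : positives (heights 0ℤ (s ∷ ss)) ≡ length ss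
    positives-Y = trans (positives-∷-nonpos (heights (0ℤ + δ s) ss) ℤP.≤-refl)
      (trans (positives-all pos) (length-heights (0ℤ + δ s) ss))
    k≡ : k ≡ length ss
    k≡ = begin
      k                                                  ≡⟨ f ⟨
      flaws (U ++ s ∷ ss)                                ≡⟨ flaws≡positives g (U ++ s ∷ ss) 0<g e ⟩
      positives (heights 0ℤ (U ++ s ∷ ss))               ≡⟨ cong positives (heights-++ 0ℤ U (s ∷ ss) endU) ⟩
      positives (heights 0ℤ U ++ heights 0ℤ (s ∷ ss))    ≡⟨ positives-++ (heights 0ℤ U) _ ⟩
      positives (heights 0ℤ U) ℕ.+ positives (heights 0ℤ (s ∷ ss))
        ≡⟨ cong₂ ℕ._+_ (positives-none (All.map ℤP.≤⇒≯ nonpos)) positives-Y ⟩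
      length ss                                          ∎
      where open ≡-Reasoning
    Y-endpt : endpt (s ∷ ss) ≡ ((g ∸ t) * a , (g ∸ t) * b)
    Y-endpt = endpt-suffix g t U (s ∷ ss) e U-endpt
    max-flaws : suc k ≡ (g ∸ t) * (a ℕ.+ b)
    max-flaws = trans (cong suc k≡) (length-diagonal (g ∸ t) (s ∷ ss) Y-endpt)
    0<j : 0 ℕ.< g ∸ t
    0<j = NP.n≢0⇒n>0 λ j≡0 → NP.0≢1+n (sym (trans max-flaws (cong (ℕ._* (a ℕ.+ b)) j≡0)))
    t<g : t ℕ.< g
    t<g = NP.m∸n≢0⇒n<m (NP.>⇒≢ 0<j)
    0<t : 0 ℕ.< t
    0<t = NP.n≢0⇒n>0 λ { refl → NP.<-irrefl (sym (length-q (length-diagonal 0 U U-endpt))) big }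
      where
      length-q : length U ≡ 0 → g * (a ℕ.+ b) ≡ suc k
      length-q U-empty = begin
        g * (a ℕ.+ b)                     ≡⟨ sym (length-diagonal g (U ++ s ∷ ss) e) ⟩
        length (U ++ s ∷ ss)              ≡⟨ length-++ U ⟩
        length U ℕ.+ suc (length ss)      ≡⟨ cong (ℕ._+ suc (length ss)) U-empty ⟩
        suc (length ss)                   ≡⟨ cong suc (sym k≡) ⟩
        suc k                             ∎
        where open ≡-Reasoning

open import Data.Nat using (_+_; _<_; _≤_)

allSeqs-unique : ∀ n → Unique (allSeqs n)
allSeqs-unique ℕ.zero    = [] ∷ []
allSeqs-unique (suc n) =
  Unique.++⁺ (Unique.map⁺ ∷-injectiveʳ (allSeqs-unique n)) (Unique.map⁺ ∷-injectiveʳ (allSeqs-unique n)) disjoint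
  where
  disjoint : ∀ {p} → ¬ (p ∈ map (E ∷_) (allSeqs n) × p ∈ map (N ∷_) (allSeqs n))
  disjoint (p∈E , p∈N) with ∈-map⁻ (E ∷_) p∈E | ∈-map⁻ (N ∷_) p∈N
  ... | _ , _ , refl | _ , _ , ()

∈-allSeqs : ∀ p → p ∈ allSeqs (length p)
∈-allSeqs []      = here refl
∈-allSeqs (E ∷ p) = ∈-++⁺ˡ (∈-map⁺ (E ∷_) (∈-allSeqs p))
∈-allSeqs (N ∷ p) = ∈-++⁺ʳ (map (E ∷_) (allSeqs (length p))) (∈-map⁺ (N ∷_) (∈-allSeqs p))

module Membership (a b : ℕ) where

  open Bridge a b

  ∈-Nkset : ∀ g k {p} → p ∈ Nkset a b g k ⇔ (endpt p ≡ (g * a , g * b) × flaws p ≡ k)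
  ∈-Nkset g k {p} = mk⇔
    (λ p∈ → let p∈N , t-k = ∈-filter⁻ (T? ∘ λ p → flaws p ℕ.≡ᵇ k) p∈
                _ , t-N = ∈-filter⁻ (T? ∘ inN a b g) {xs = allSeqs (g * a + g * b)} p∈N
            in to (T-inN g p) t-N , NP.≡ᵇ⇒≡ _ _ t-k)
    (λ (e , f) → ∈-filter⁺ (T? ∘ λ p → flaws p ℕ.≡ᵇ k)
      (∈-filter⁺ (T? ∘ inN a b g) (subst (λ n → p ∈ allSeqs n) (length-n e) (∈-allSeqs p)) (from (T-inN g p) e))
      (NP.≡⇒≡ᵇ _ _ f))
    where
    length-n : endpt p ≡ (g * a , g * b) → length p ≡ g * a + g * b
    length-n e = trans (length≡x+y p) (cong (λ q → proj₁ q + proj₂ q) e)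

  ∈-NkMinusSk : ∀ g k {p} → p ∈ NkMinusSk a b g k ⇔ (p ∈ Nkset a b g k × ¬ T (inS a b g k p))
  ∈-NkMinusSk g k {p} = mk⇔
    (λ p∈ → let p∈Nk , t = ∈-filter⁻ (T? ∘ λ p → not (inS a b g k p)) p∈ in p∈Nk , T-not⁻ t)
    (λ (p∈Nk , ¬t) → ∈-filter⁺ (T? ∘ λ p → not (inS a b g k p)) p∈Nk (T-not⁺ ¬t))
    where
    T-not⁻ : ∀ {x} → T (not x) → ¬ T x
    T-not⁻ {false} _ ()
    T-not⁺ : ∀ {x} → ¬ T x → T (not x)
    T-not⁺ {false} _ = _
    T-not⁺ {true}  ¬t = ¬t _

  Nkset-unique : ∀ g k → Unique (Nkset a b g k)
  Nkset-unique g k = Unique.filter⁺ (T? ∘ λ p → flaws p ℕ.≡ᵇ k)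
    (Unique.filter⁺ (T? ∘ inN a b g) (allSeqs-unique (g * a + g * b)))

  NkMinusSk-unique : ∀ g k → Unique (NkMinusSk a b g k)
  NkMinusSk-unique g k = Unique.filter⁺ (T? ∘ λ p → not (inS a b g k p)) (Nkset-unique g k)

module Correspondence (a b : ℕ) (0<a : 0 < a) (cop : Coprime a b) (g k : ℕ) (0<g : 0 < g)
                      (bound : suc k < g * (a + b)) where

  open Heights a b
  open LowerRaise a b
  open Bridge a b
  open Membership a b

  lower-on-Nkset : ∀ {p} → p ∈ Nkset a b g (suc k) → Exchange p (lower p) × raise (lower p) ≡ p
  lower-on-Nkset {p} p∈ with e , f ← to (∈-Nkset g (suc k)) p∈ =
    lower-spec p (endpt⇒closed g p e) (subst (0 <_) (trans (sym f) (flaws≡positives g p 0<g e)) ℕ.z<s)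

  raise-on-NkMinusSk : ∀ {q} → q ∈ NkMinusSk a b g k → Exchange (raise q) q × lower (raise q) ≡ q
  raise-on-NkMinusSk {q} q∈
    with q∈Nk , ¬inS ← to (∈-NkMinusSk g k) q∈
    with e , f ← to (∈-Nkset g k) q∈Nk = raise-spec q q≢[] (endpt⇒closed g q e) ¬split
    where
    q≢[] : q ≢ []
    q≢[] refl = NP.n≮0 (subst (suc k <_) (sym (length-diagonal g [] e)) bound)
    ¬split : ¬ Split q
    ¬split sp = ¬inS (SDecomposition⇒inS g k q (from (T-inNk g k q) (e , f))
                                          (Split⇒SDecomposition cop 0<a g k q e f bound sp))

  lower-into : ∀ {p} → p ∈ Nkset a b g (suc k) → lower p ∈ NkMinusSk a b g k
  lower-into {p} p∈
    with e , f ← to (∈-Nkset g (suc k)) p∈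
    with exchange blocks one-less , raised ← lower-on-Nkset p∈ =
    from (∈-NkMinusSk g k) (from (∈-Nkset g k) (e′ , flaws-k) , ¬inS)
    where
    e′ : endpt (lower p) ≡ (g * a , g * b)
    e′ = trans (sym (endpt-swap blocks)) e
    flaws-k : flaws (lower p) ≡ k
    flaws-k = NP.suc-injective (begin
      suc (flaws (lower p))                   ≡⟨ cong suc (flaws≡positives g (lower p) 0<g e′) ⟩
      suc (positives (heights 0ℤ (lower p)))  ≡⟨ one-less ⟨
      positives (heights 0ℤ p)                ≡⟨ flaws≡positives g p 0<g e ⟨
      flaws p                                 ≡⟨ f ⟩
      suc k                                   ∎)
      where open ≡-Reasoning
    ¬inS : ¬ T (inS a b g k (lower p))
    ¬inS t = NP.1+n≢n (sym (trans (cong (positives ∘ heights 0ℤ) lower≡p) one-less))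
      where
      lower≡p : lower p ≡ p
      lower≡p = trans (sym (raise-split (SDecomposition⇒Split (inS⇒SDecomposition g k (lower p) t)))) raised

  raise-into : ∀ {q} → q ∈ NkMinusSk a b g k → raise q ∈ Nkset a b g (suc k)
  raise-into {q} q∈
    with q∈Nk , _ ← to (∈-NkMinusSk g k) q∈
    with e , f ← to (∈-Nkset g k) q∈Nk
    with exchange blocks one-more , _ ← raise-on-NkMinusSk q∈ =
    from (∈-Nkset g (suc k)) (e′ , flaws-suc-k)
    where
    e′ : endpt (raise q) ≡ (g * a , g * b)
    e′ = trans (endpt-swap blocks) e
    flaws-suc-k : flaws (raise q) ≡ suc k
    flaws-suc-k = begin
      flaws (raise q)                        ≡⟨ flaws≡positives g (raise q) 0<g e′ ⟩
      positives (heights 0ℤ (raise q))       ≡⟨ one-more ⟩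
      suc (positives (heights 0ℤ q))         ≡⟨ cong suc (flaws≡positives g q 0<g e) ⟨
      suc (flaws q)                          ≡⟨ cong suc f ⟩
      suc k                                  ∎
      where open ≡-Reasoning

theorem1p5 : (a b : ℕ) → 0 < a → 0 < b → Coprime a b →
    (g k : ℕ) → 1 ≤ g → k + 1 < g * (a + b) →
    length (NkMinusSk a b g k) ≡ length (Nkset a b g (k + 1))
theorem1p5 a b 0<a _ cop g k 1≤g bound rewrite NP.+-comm k 1 =
  inverseOn⇒length≡ (NkMinusSk-unique g k) (Nkset-unique g (suc k)) raise lower raise-into lower-into
    (proj₂ ∘ raise-on-NkMinusSk) (proj₂ ∘ lower-on-Nkset)
  where
  open LowerRaise a b
  open Membership a b
  open Correspondence a b 0<a cop g k 1≤g bound
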